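{- Let $j$ be a positive integer, $m\geqslant 5$ a prime and $k\geqslant 2$ an integer. Define $$f_{k,m,j}:=\left(\left\{\frac{\eta(24kz)\,\eta^m(24mz)}{\eta(24z)}\right\}\Big| U(m)\right)\cdot\frac{\eta^{m^{j+1}-m}(24z)}{\eta^{m^j}(24mz)}.$$ Then $$f_{k,m,j}\equiv \sum_{\substack{n\geqslant 0\\ mn\equiv k-1 \ (\mathrm{mod}\ 24)}} b_k\!\left(\frac{mn-k+1}{24}\right)q^n \pmod{m^{j+1}}.$$
   Context: $q=e^{2\pi i z}$ and $\eta(z)=q^{1/24}\prod_{n\ge1}(1-q^n)$ is the Dedekind eta function; the eta quotients above are regarded as power series in $q$ with integer coefficients (all exponents of $q$ are integers). For a power series $\sum_{n\ge0}a(n)q^n$ and a positive integer $d$, $\left(\sum a(n)q^n\right)\mid U(d)=\sum_{n\ge0}a(dn)q^n$. For an integer $k\geqslant 2$, $b_k(n)$ denotes the number of partitions of $n$ none of whose parts is divisible by $k$, with $b_k(0)=1$ and $b_k(x)=0$ whenever $x$ is not a nonnegative integer; equivalently $\sum_{n\ge0}b_k(n)q^n=\prod_{n\ge1}\frac{1-q^{kn}}{1-q^n}$. The congruence is coefficientwise. -}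

module Defs where

open import Data.Nat as ℕ using (ℕ; zero; suc; _∸_)
open import Data.Nat.Divisibility as ℕD using ()
open import Data.Nat.DivMod using (_/_)
open import Data.Integer as ℤ using (ℤ; +_; _⊓_)
open import Relation.Nullary using (yes; no)
open import Data.Bool using (if_then_else_; _∧_)
open import Relation.Nullary.Decidable using (⌊_⌋)

PS : Set
PS = ℕ → ℤ

sumUpTo : ℕ → (ℕ → ℤ) → ℤ
sumUpTo zero    f = f 0
sumUpTo (suc n) f = sumUpTo n f ℤ.+ f (suc n)

_⊛_ : PS → PS → PS
(f ⊛ g) n = sumUpTo n (λ i → f i ℤ.* g (n ∸ i))

onePS : PS
onePS zero    = ℤ.1ℤ
onePS (suc _) = ℤ.0ℤ

powPS : PS → ℕ → PS
powPS f zero    = onePS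
powPS f (suc e) = f ⊛ powPS f e

oneMinusQ : ℕ → PS
oneMinusQ a n = onePS n ℤ.- (if ⌊ n ℕ.≟ a ⌋ then ℤ.1ℤ else ℤ.0ℤ)

-- the series 1/(1 - q^a) = Σ_{r≥0} q^{a r}   (used with a ≥ 1)
geomQ : ℕ → PS
geomQ a n = if ⌊ a ℕD.∣? n ⌋ then ℤ.1ℤ else ℤ.0ℤ

finProd : ℕ → (ℕ → PS) → PS
finProd zero    F = onePS
finProd (suc N) F = finProd N F ⊛ F N

-- ∏_{n≥1} (1 - q^{a n}) for a ≥ 1 : the coefficient of q^N only depends on the
-- factors with n ≤ N.
eulerProd : ℕ → PS
eulerProd a N = finProd N (λ n → oneMinusQ (a ℕ.* suc n)) N

eulerProdInv : ℕ → PS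
eulerProdInv a N = finProd N (λ n → geomQ (a ℕ.* suc n)) N

-- Laurent series with bounded-below support: q^shift · Σ coeffs(n) q^n
record Laurent : Set where
  constructor ⟨_,_⟩
  field
    shift  : ℤ
    coeffs : PS
open Laurent public

coeffAt : Laurent → ℤ → ℤ
coeffAt L e with shift L ℤ.≤? e
... | yes _ = coeffs L ℤ.∣ e ℤ.- shift L ∣
... | no  _ = ℤ.0ℤ

_·L_ : Laurent → Laurent → Laurent
⟨ s , f ⟩ ·L ⟨ t , g ⟩ = ⟨ s ℤ.+ t , f ⊛ g ⟩

oneL : Laurent
oneL = ⟨ ℤ.0ℤ , onePS ⟩

powL : Laurent → ℕ → Laurent
powL L zero    = oneL
powL L (suc e) = L ·L powL L e

-- U(d): Σ a(n) q^n ↦ Σ a(d n) q^n  (used with d ≥ 1).  The new shift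
-- min(s,0) satisfies d·min(s,0) ≤ s, so no coefficient is lost.
U : ℕ → Laurent → Laurent
U d L = ⟨ s' , (λ n → coeffAt L (+ d ℤ.* (s' ℤ.+ + n))) ⟩
  where s' = shift L ⊓ ℤ.0ℤ

-- η(24 δ z) = q^δ ∏_{n≥1} (1 - q^{24 δ n})  (q = e^{2πiz}), for δ ≥ 1
eta24 : ℕ → Laurent
eta24 δ = ⟨ + δ , eulerProd (24 ℕ.* δ) ⟩

eta24Inv : ℕ → Laurent
eta24Inv δ = ⟨ ℤ.- (+ δ) , eulerProdInv (24 ℕ.* δ) ⟩

fkmj : ℕ → ℕ → ℕ → Laurent
fkmj k m j =
  U m (eta24 k ·L (powL (eta24 m) m ·L eta24Inv 1))
  ·L (powL (eta24 1) (m ℕ.^ suc j ∸ m) ·L powL (eta24Inv m) (m ℕ.^ j))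

-- Number of partitions of n into parts ≤ b, none divisible by k
-- (choose the multiplicity r of the largest allowed part size b).
sumNat : ℕ → (ℕ → ℕ) → ℕ
sumNat zero    f = f 0
sumNat (suc n) f = sumNat n f ℕ.+ f (suc n)

partsBounded : ℕ → ℕ → ℕ → ℕ
partsBounded k zero    n = if ⌊ n ℕ.≟ 0 ⌋ then 1 else 0
partsBounded k (suc b) n =
  if ⌊ k ℕD.∣? suc b ⌋
  then partsBounded k b n
  else sumNat n (λ r → if ⌊ r ℕ.* suc b ℕ.≤? n ⌋ then partsBounded k b (n ∸ r ℕ.* suc b) else 0)

bk : ℕ → ℕ → ℕ
bk k n = partsBounded k n n

-- coefficient of q^e on the right-hand side:
-- b_k((m n - k + 1)/24) if e = n ≥ 0 and m n ≡ k-1 (mod 24), else 0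
-- (b_k(x) = 0 if x is not a nonnegative integer).
rhsCoeff : ℕ → ℕ → ℤ → ℤ
rhsCoeff k m (ℤ.negsuc _) = ℤ.0ℤ
rhsCoeff k m (+ n) =
  if ⌊ (k ∸ 1) ℕ.≤? m ℕ.* n ⌋ ∧ ⌊ 24 ℕD.∣? (m ℕ.* n ∸ (k ∸ 1)) ⌋
  then + bk k ((m ℕ.* n ∸ (k ∸ 1)) / 24)
  else ℤ.0ℤ

{-# OPTIONS --safe #-}
-- Work in the commutative ring ℤ[[q]] modulo M. With E(a) = ∏ₙ (1 - q^{an}), the eta
-- quotient inside U(m) is q^{k-1} B(q^{24}) · q^{m²} E(24)^m(q^m), where
-- B = E(k)/E(1) = Σ b_k(n) qⁿ. The second factor is a series in q^m, so U(m) passes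
-- through it, and f is q^{-m} · (Σ b_k((mn-k+1)/24) qⁿ) · q^m E(24)^{m^{j+1}} / E(24m)^{m^j}.
-- Finally (1 - q^a)^p ≡ 1 - q^{ap} (mod p), and F ≡ G (mod p^i) with i ≥ 1 gives
-- F^p ≡ G^p (mod p^{i+1}); hence E(24)^{m^{j+1}} ≡ E(24m)^{m^j} (mod m^{j+1}) and the
-- eta factors cancel.
module Submission where

open import Defs
open import Data.Nat using (ℕ; suc; _≤_; _^_)
open import Data.Nat.Primality using (Prime)
open import Data.Integer using (ℤ; +_; _-_)
open import Data.Integer.Divisibility using (_∣_)

open import Data.Nat using (zero; _+_; _*_; _∸_; _<_; z≤n; s≤s; NonZero; NonTrivial)
import Data.Nat as ℕ
import Data.Nat.Properties as ℕP
import Data.Nat.Divisibility as ℕD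
open import Data.Nat.DivMod using (_/_; m*n/n≡m; m/n≤m)
open import Data.Nat.Combinatorics using (_C_; nCk+nC[k+1]≡[n+1]C[k+1]; k>n⇒nCk≡0; nC1≡n; nCn≡1)
open import Data.Nat.Primality using (euclidsLemma; prime⇒nonZero; prime⇒nonTrivial)
import Data.Nat.Tactic.RingSolver as ℕSolver
open import Data.Integer as ℤ using (-[1+_])
import Data.Integer.Properties as ℤP
import Data.Integer.Divisibility.Signed as ℤD
open import Data.Integer.Tactic.RingSolver using (solve-∀)
open import Data.Bool using (if_then_else_)
open import Data.Empty using (⊥-elim)
open import Data.Fin using (Fin; toℕ; fromℕ) renaming (zero to fzero; suc to fsuc)
import Data.Fin.Properties as FinP
open import Data.Fin.Patterns using (0F; 1F; 2F; 3F; 4F)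
open import Data.Product using (_,_)
open import Data.Sum using (inj₁; inj₂)
open import Data.Vec using (_∷_; [])
open import Data.Vec.Functional using (tail)
open import Level using (0ℓ)
open import Relation.Binary.PropositionalEquality
open import Relation.Nullary using (Dec; yes; no; ¬_)
open import Relation.Nullary.Decidable using (⌊_⌋)
open import Algebra.Bundles using (CommutativeRing)
open import Algebra.Structures using (IsCommutativeRing)
import Algebra.Solver.CommutativeMonoid as CommutativeMonoidSolver
import Algebra.Properties.Semiring.Exp as SemiringExp
import Algebra.Properties.CommutativeSemiring.Exp as CommutativeSemiringExp
import Algebra.Properties.CommutativeSemiring.Binomial as Binomial
import Algebra.Properties.Monoid.Sum as MonoidSum
import Algebra.Properties.Semiring.Mult as SemiringMult
import Algebra.Properties.Group as GroupProperties
import Algebra.Properties.Ring as RingProperties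
import Relation.Binary.Reasoning.Setoid as SetoidReasoning

infix 4 _≡[_]_ _≈[_]_

-- A record, so that the modulus and both sides can be inferred from the type.
record _≡[_]_ (a : ℤ) (M : ℕ) (b : ℤ) : Set where
  constructor mk≡
  field divides-difference : (+ M) ℤD.∣ (a - b)
open _≡[_]_ public

module _ {M : ℕ} where

  ≡[]-reflexive : ∀ {a b} → a ≡ b → a ≡[ M ] b
  ≡[]-reflexive {a} refl = mk≡ (subst (+ M ℤD.∣_) (sym (ℤP.+-inverseʳ a)) (ℤD.∣n⇒∣m*n ℤ.0ℤ ℤD.∣-refl))

  ≡[]-refl : ∀ a → a ≡[ M ] a
  ≡[]-refl a = ≡[]-reflexive refl

  ≡[]-sym : ∀ {a b} → a ≡[ M ] b → b ≡[ M ] a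
  ≡[]-sym {a} {b} (mk≡ p) = mk≡ (subst (+ M ℤD.∣_) (negate-difference a b) (ℤD.∣m⇒∣-m p))
    where
    negate-difference : ∀ a b → ℤ.- (a - b) ≡ b - a
    negate-difference = solve-∀

  ≡[]-trans : ∀ {a b c} → a ≡[ M ] b → b ≡[ M ] c → a ≡[ M ] c
  ≡[]-trans {a} {b} {c} (mk≡ p) (mk≡ q) = mk≡ (subst (+ M ℤD.∣_) (telescope a b c) (ℤD.∣m∣n⇒∣m+n p q))
    where
    telescope : ∀ a b c → (a - b) ℤ.+ (b - c) ≡ a - c
    telescope = solve-∀

  ≡[]-+ : ∀ {a b c d} → a ≡[ M ] b → c ≡[ M ] d → a ℤ.+ c ≡[ M ] b ℤ.+ d
  ≡[]-+ {a} {b} {c} {d} (mk≡ p) (mk≡ q) = mk≡ (subst (+ M ℤD.∣_) (regroup a b c d) (ℤD.∣m∣n⇒∣m+n p q))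
    where
    regroup : ∀ a b c d → (a - b) ℤ.+ (c - d) ≡ (a ℤ.+ c) - (b ℤ.+ d)
    regroup = solve-∀

  ≡[]-* : ∀ {a b c d} → a ≡[ M ] b → c ≡[ M ] d → a ℤ.* c ≡[ M ] b ℤ.* d
  ≡[]-* {a} {b} {c} {d} (mk≡ p) (mk≡ q) =
    mk≡ (subst (+ M ℤD.∣_) (regroup a b c d) (ℤD.∣m∣n⇒∣m+n (ℤD.∣m⇒∣m*n c p) (ℤD.∣n⇒∣m*n b q)))
    where
    regroup : ∀ a b c d → (a - b) ℤ.* c ℤ.+ b ℤ.* (c - d) ≡ a ℤ.* c - b ℤ.* d
    regroup = solve-∀

  ≡[]-neg : ∀ {a b} → a ≡[ M ] b → ℤ.- a ≡[ M ] ℤ.- b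
  ≡[]-neg {a} {b} (mk≡ p) = mk≡ (subst (+ M ℤD.∣_) (regroup a b) (ℤD.∣m⇒∣-m p))
    where
    regroup : ∀ a b → ℤ.- (a - b) ≡ ℤ.- a - ℤ.- b
    regroup = solve-∀

  ≡[]-0 : ∀ {a} → (+ M) ℤD.∣ a → a ≡[ M ] ℤ.0ℤ
  ≡[]-0 {a} p = mk≡ (subst (+ M ℤD.∣_) (sym (ℤP.+-identityʳ a)) p)

≡[0]⇒≡ : ∀ {a b} → a ≡[ 0 ] b → a ≡ b
≡[0]⇒≡ {a} {b} (mk≡ p) = ℤP.i-j≡0⇒i≡j a b (ℤD.0∣⇒≡0 p)

*-∣-* : ∀ {a b x y} → (+ a) ℤD.∣ x → (+ b) ℤD.∣ y → (+ (a * b)) ℤD.∣ (x ℤ.* y)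
*-∣-* {a} {b} {x} a∣x b∣y =
  subst (ℤD._∣ x ℤ.* _) (sym (ℤP.pos-* a b)) (ℤD.∣-trans (ℤD.*-monoˡ-∣ (+ b) a∣x) (ℤD.*-monoʳ-∣ x b∣y))

sumUpTo-cong : ∀ n {f g} → (∀ i → i ≤ n → f i ≡ g i) → sumUpTo n f ≡ sumUpTo n g
sumUpTo-cong zero    f≡g = f≡g 0 z≤n
sumUpTo-cong (suc n) f≡g =
  cong₂ ℤ._+_ (sumUpTo-cong n (λ i i≤n → f≡g i (ℕP.m≤n⇒m≤1+n i≤n))) (f≡g (suc n) ℕP.≤-refl)

sumUpTo-congᴹ : ∀ {M} n {f g} → (∀ i → i ≤ n → f i ≡[ M ] g i) → sumUpTo n f ≡[ M ] sumUpTo n g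
sumUpTo-congᴹ zero    f≡g = f≡g 0 z≤n
sumUpTo-congᴹ (suc n) f≡g =
  ≡[]-+ (sumUpTo-congᴹ n (λ i i≤n → f≡g i (ℕP.m≤n⇒m≤1+n i≤n))) (f≡g (suc n) ℕP.≤-refl)

sumUpTo-∣ : ∀ {c} n (f : ℕ → ℤ) → (∀ i → c ℤD.∣ f i) → c ℤD.∣ sumUpTo n f
sumUpTo-∣ zero    f c∣f = c∣f 0
sumUpTo-∣ (suc n) f c∣f = ℤD.∣m∣n⇒∣m+n (sumUpTo-∣ n f c∣f) (c∣f (suc n))

sumUpTo-distrib-+ : ∀ n f g → sumUpTo n (λ i → f i ℤ.+ g i) ≡ sumUpTo n f ℤ.+ sumUpTo n g
sumUpTo-distrib-+ zero    f g = refl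
sumUpTo-distrib-+ (suc n) f g =
  trans (cong (ℤ._+ (f (suc n) ℤ.+ g (suc n))) (sumUpTo-distrib-+ n f g))
        (middle-four (sumUpTo n f) (sumUpTo n g) (f (suc n)) (g (suc n)))
  where
  middle-four : ∀ a b c d → (a ℤ.+ b) ℤ.+ (c ℤ.+ d) ≡ (a ℤ.+ c) ℤ.+ (b ℤ.+ d)
  middle-four = solve-∀

sumUpTo-*ˡ : ∀ n c f → sumUpTo n (λ i → c ℤ.* f i) ≡ c ℤ.* sumUpTo n f
sumUpTo-*ˡ zero    c f = refl
sumUpTo-*ˡ (suc n) c f =
  trans (cong (ℤ._+ (c ℤ.* f (suc n))) (sumUpTo-*ˡ n c f)) (sym (ℤP.*-distribˡ-+ c (sumUpTo n f) (f (suc n))))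

sumUpTo-zero : ∀ n → sumUpTo n (λ _ → ℤ.0ℤ) ≡ ℤ.0ℤ
sumUpTo-zero zero    = refl
sumUpTo-zero (suc n) = cong (ℤ._+ ℤ.0ℤ) (sumUpTo-zero n)

sumUpTo-head : ∀ n f → sumUpTo (suc n) f ≡ f 0 ℤ.+ sumUpTo n (λ i → f (suc i))
sumUpTo-head zero    f = refl
sumUpTo-head (suc n) f =
  trans (cong (ℤ._+ f (suc (suc n))) (sumUpTo-head n f))
        (ℤP.+-assoc (f 0) (sumUpTo n (λ i → f (suc i))) (f (suc (suc n))))

sumUpTo-reverse : ∀ n f → sumUpTo n f ≡ sumUpTo n (λ i → f (n ∸ i))
sumUpTo-reverse zero    f = refl
sumUpTo-reverse (suc n) f =
  trans (cong (ℤ._+ f (suc n)) (sumUpTo-reverse n f))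
        (trans (ℤP.+-comm (sumUpTo n (λ i → f (n ∸ i))) (f (suc n)))
               (sym (sumUpTo-head n (λ i → f (suc n ∸ i)))))

sumUpTo-triangle : ∀ (T : ℕ → ℕ → ℤ) n →
  sumUpTo n (λ i → sumUpTo i (λ a → T a i)) ≡ sumUpTo n (λ a → sumUpTo (n ∸ a) (λ b → T a (a + b)))
sumUpTo-triangle T zero    = refl
sumUpTo-triangle T (suc n) = begin
    sumUpTo n (λ i → sumUpTo i (λ a → T a i)) ℤ.+ (column ℤ.+ T (suc n) (suc n))
  ≡⟨ cong (ℤ._+ (column ℤ.+ T (suc n) (suc n))) (sumUpTo-triangle T n) ⟩
    rows n ℤ.+ (column ℤ.+ T (suc n) (suc n))
  ≡⟨ sym (ℤP.+-assoc (rows n) column (T (suc n) (suc n))) ⟩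
    (rows n ℤ.+ column) ℤ.+ T (suc n) (suc n)
  ≡⟨ cong₂ ℤ._+_ (sym (sumUpTo-distrib-+ n _ _)) (cong (T (suc n)) (sym (ℕP.+-identityʳ (suc n)))) ⟩
    sumUpTo n (λ a → row n a ℤ.+ T a (suc n)) ℤ.+ T (suc n) (suc n + 0)
  ≡⟨ cong (ℤ._+ T (suc n) (suc n + 0)) (sumUpTo-cong n extend-row) ⟩
    sumUpTo n (row (suc n)) ℤ.+ T (suc n) (suc n + 0)
  ≡⟨ cong (λ x → sumUpTo n (row (suc n)) ℤ.+ sumUpTo x (λ b → T (suc n) (suc n + b))) (sym (ℕP.n∸n≡0 n)) ⟩
    sumUpTo (suc n) (row (suc n))
  ∎
  where
  open ≡-Reasoning
  row : ℕ → ℕ → ℤ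
  row N a = sumUpTo (N ∸ a) (λ b → T a (a + b))
  rows : ℕ → ℤ
  rows N = sumUpTo N (row N)
  column : ℤ
  column = sumUpTo n (λ a → T a (suc n))
  extend-row : ∀ a → a ≤ n → row n a ℤ.+ T a (suc n) ≡ row (suc n) a
  extend-row a a≤n rewrite ℕP.+-∸-assoc 1 a≤n =
    cong (λ x → row n a ℤ.+ T a x) (trans (cong suc (sym (ℕP.m+[n∸m]≡n a≤n))) (sym (ℕP.+-suc a (n ∸ a))))

sumBelow : ℕ → (ℕ → ℤ) → ℤ
sumBelow zero    f = ℤ.0ℤ
sumBelow (suc n) f = sumBelow n f ℤ.+ f n

sumUpTo≡sumBelow : ∀ n f → sumUpTo n f ≡ sumBelow (suc n) f
sumUpTo≡sumBelow zero    f = sym (ℤP.+-identityˡ (f 0))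
sumUpTo≡sumBelow (suc n) f = cong (ℤ._+ f (suc n)) (sumUpTo≡sumBelow n f)

sumBelow-cong : ∀ n {f g} → (∀ i → i < n → f i ≡ g i) → sumBelow n f ≡ sumBelow n g
sumBelow-cong zero    f≡g = refl
sumBelow-cong (suc n) f≡g =
  cong₂ ℤ._+_ (sumBelow-cong n (λ i i<n → f≡g i (ℕP.m<n⇒m<1+n i<n))) (f≡g n ℕP.≤-refl)

sumBelow-zero : ∀ n {f} → (∀ i → i < n → f i ≡ ℤ.0ℤ) → sumBelow n f ≡ ℤ.0ℤ
sumBelow-zero n {f} f≡0 = trans (sumBelow-cong n f≡0) (zeros n)
  where
  zeros : ∀ n → sumBelow n (λ _ → ℤ.0ℤ) ≡ ℤ.0ℤ
  zeros zero    = refl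
  zeros (suc n) = cong (ℤ._+ ℤ.0ℤ) (zeros n)

sumBelow-split : ∀ a d f → sumBelow (a + d) f ≡ sumBelow a f ℤ.+ sumBelow d (λ r → f (a + r))
sumBelow-split a zero    f =
  trans (cong (λ x → sumBelow x f) (ℕP.+-identityʳ a)) (sym (ℤP.+-identityʳ (sumBelow a f)))
sumBelow-split a (suc d) f = begin
    sumBelow (a + suc d) f
  ≡⟨ cong (λ x → sumBelow x f) (ℕP.+-suc a d) ⟩
    sumBelow (a + d) f ℤ.+ f (a + d)
  ≡⟨ cong (ℤ._+ f (a + d)) (sumBelow-split a d f) ⟩
    (sumBelow a f ℤ.+ sumBelow d (λ r → f (a + r))) ℤ.+ f (a + d)
  ≡⟨ ℤP.+-assoc (sumBelow a f) (sumBelow d (λ r → f (a + r))) (f (a + d)) ⟩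
    sumBelow a f ℤ.+ sumBelow (suc d) (λ r → f (a + r))
  ∎
  where open ≡-Reasoning

sumBelow-head : ∀ n f → sumBelow (suc n) f ≡ f 0 ℤ.+ sumBelow n (λ i → f (suc i))
sumBelow-head n f = trans (sumBelow-split 1 n f) (cong (ℤ._+ sumBelow n (λ i → f (suc i))) (ℤP.+-identityˡ (f 0)))

sumBelow-extend : ∀ N L (f : ℕ → ℤ) → N ≤ L → (∀ i → N ≤ i → f i ≡ ℤ.0ℤ) → sumBelow L f ≡ sumBelow N f
sumBelow-extend N L f N≤L f≡0 = begin
    sumBelow L f
  ≡⟨ cong (λ x → sumBelow x f) (sym (ℕP.m+[n∸m]≡n N≤L)) ⟩
    sumBelow (N + (L ∸ N)) f
  ≡⟨ sumBelow-split N (L ∸ N) f ⟩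
    sumBelow N f ℤ.+ sumBelow (L ∸ N) (λ r → f (N + r))
  ≡⟨ cong (ℤ._+_ (sumBelow N f)) (sumBelow-zero (L ∸ N) (λ r _ → f≡0 (N + r) (ℕP.m≤m+n N r))) ⟩
    sumBelow N f ℤ.+ ℤ.0ℤ
  ≡⟨ ℤP.+-identityʳ (sumBelow N f) ⟩
    sumBelow N f
  ∎
  where open ≡-Reasoning

+-sumNat : ∀ n (f : ℕ → ℕ) → + sumNat n f ≡ sumBelow (suc n) (λ r → + f r)
+-sumNat zero    f = refl
+-sumNat (suc n) f = trans (ℤP.pos-+ (sumNat n f) (f (suc n))) (cong (ℤ._+ (+ f (suc n))) (+-sumNat n f))

-- Power series modulo M

_≈[_]_ : PS → ℕ → PS → Set
f ≈[ M ] g = ∀ n → f n ≡[ M ] g n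

infixl 6 _⊕_
_⊕_ : PS → PS → PS
(f ⊕ g) n = f n ℤ.+ g n

⊖_ : PS → PS
(⊖ f) n = ℤ.- f n

zeroPS : PS
zeroPS _ = ℤ.0ℤ

≗⇒≈ : ∀ {M f g} → f ≗ g → f ≈[ M ] g
≗⇒≈ f≗g n = ≡[]-reflexive (f≗g n)

≈[0]⇒≗ : ∀ {f g} → f ≈[ 0 ] g → f ≗ g
≈[0]⇒≗ f≈g n = ≡[0]⇒≡ (f≈g n)

⊛-cong : ∀ {f f′ g g′} → f ≗ f′ → g ≗ g′ → (f ⊛ g) ≗ (f′ ⊛ g′)
⊛-cong f≗f′ g≗g′ n = sumUpTo-cong n (λ i _ → cong₂ ℤ._*_ (f≗f′ i) (g≗g′ (n ∸ i)))

⊛-congˡ : ∀ {f f′} g → f ≗ f′ → (f ⊛ g) ≗ (f′ ⊛ g)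
⊛-congˡ {f} {f′} g f≗f′ = ⊛-cong {f} {f′} {g} {g} f≗f′ (λ _ → refl)

⊛-congʳ : ∀ f {g g′} → g ≗ g′ → (f ⊛ g) ≗ (f ⊛ g′)
⊛-congʳ f {g} {g′} g≗g′ = ⊛-cong {f} {f} {g} {g′} (λ _ → refl) g≗g′

⊛-congᴹ : ∀ {M f f′ g g′} → f ≈[ M ] f′ → g ≈[ M ] g′ → (f ⊛ g) ≈[ M ] (f′ ⊛ g′)
⊛-congᴹ f≈f′ g≈g′ n = sumUpTo-congᴹ n (λ i _ → ≡[]-* (f≈f′ i) (g≈g′ (n ∸ i)))

⊛-comm : ∀ f g → (f ⊛ g) ≗ (g ⊛ f)
⊛-comm f g n = trans (sumUpTo-reverse n (λ i → f i ℤ.* g (n ∸ i)))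
  (sumUpTo-cong n λ i i≤n → trans (cong (λ x → f (n ∸ i) ℤ.* g x) (ℕP.m∸[m∸n]≡n i≤n)) (ℤP.*-comm (f (n ∸ i)) (g i)))

⊛-identityˡ : ∀ f → (onePS ⊛ f) ≗ f
⊛-identityˡ f zero    = ℤP.*-identityˡ (f 0)
⊛-identityˡ f (suc n) = begin
    sumUpTo (suc n) (λ i → onePS i ℤ.* f (suc n ∸ i))
  ≡⟨ sumUpTo-head n (λ i → onePS i ℤ.* f (suc n ∸ i)) ⟩
    ℤ.1ℤ ℤ.* f (suc n) ℤ.+ sumUpTo n (λ i → ℤ.0ℤ ℤ.* f (n ∸ i))
  ≡⟨ cong (ℤ._+_ (ℤ.1ℤ ℤ.* f (suc n))) (trans (sumUpTo-cong n (λ i _ → ℤP.*-zeroˡ (f (n ∸ i)))) (sumUpTo-zero n)) ⟩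
    ℤ.1ℤ ℤ.* f (suc n) ℤ.+ ℤ.0ℤ
  ≡⟨ trans (ℤP.+-identityʳ _) (ℤP.*-identityˡ (f (suc n))) ⟩
    f (suc n)
  ∎
  where open ≡-Reasoning

⊛-identityʳ : ∀ f → (f ⊛ onePS) ≗ f
⊛-identityʳ f n = trans (⊛-comm f onePS n) (⊛-identityˡ f n)

⊛-distribˡ-⊕ : ∀ f g h → (f ⊛ (g ⊕ h)) ≗ ((f ⊛ g) ⊕ (f ⊛ h))
⊛-distribˡ-⊕ f g h n = trans (sumUpTo-cong n (λ i _ → ℤP.*-distribˡ-+ (f i) (g (n ∸ i)) (h (n ∸ i))))
  (sumUpTo-distrib-+ n (λ i → f i ℤ.* g (n ∸ i)) (λ i → f i ℤ.* h (n ∸ i)))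

⊛-distribʳ-⊕ : ∀ f g h → ((g ⊕ h) ⊛ f) ≗ ((g ⊛ f) ⊕ (h ⊛ f))
⊛-distribʳ-⊕ f g h n = trans (⊛-comm (g ⊕ h) f n)
  (trans (⊛-distribˡ-⊕ f g h n) (cong₂ ℤ._+_ (⊛-comm f g n) (⊛-comm f h n)))

⊛-assoc : ∀ f g h → ((f ⊛ g) ⊛ h) ≗ (f ⊛ (g ⊛ h))
⊛-assoc f g h n = begin
    sumUpTo n (λ i → sumUpTo i (λ a → f a ℤ.* g (i ∸ a)) ℤ.* h (n ∸ i))
  ≡⟨ sumUpTo-cong n (λ i _ → trans (ℤP.*-comm _ (h (n ∸ i))) (trans (sym (sumUpTo-*ˡ i (h (n ∸ i)) _))
        (sumUpTo-cong i (λ a _ → ℤP.*-comm (h (n ∸ i)) _)))) ⟩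
    sumUpTo n (λ i → sumUpTo i (λ a → f a ℤ.* g (i ∸ a) ℤ.* h (n ∸ i)))
  ≡⟨ sumUpTo-triangle (λ a i → f a ℤ.* g (i ∸ a) ℤ.* h (n ∸ i)) n ⟩
    sumUpTo n (λ a → sumUpTo (n ∸ a) (λ b → f a ℤ.* g (a + b ∸ a) ℤ.* h (n ∸ (a + b))))
  ≡⟨ sumUpTo-cong n (λ a _ → trans (sumUpTo-cong (n ∸ a) (λ b _ → reindex a b))
        (sumUpTo-*ˡ (n ∸ a) (f a) (λ b → g b ℤ.* h (n ∸ a ∸ b)))) ⟩
    sumUpTo n (λ a → f a ℤ.* sumUpTo (n ∸ a) (λ b → g b ℤ.* h (n ∸ a ∸ b)))
  ∎
  where
  open ≡-Reasoning
  reindex : ∀ a b → f a ℤ.* g (a + b ∸ a) ℤ.* h (n ∸ (a + b)) ≡ f a ℤ.* (g b ℤ.* h (n ∸ a ∸ b))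
  reindex a b = trans (cong₂ (λ x y → f a ℤ.* g x ℤ.* h y) (ℕP.m+n∸m≡n a b) (sym (ℕP.∸-+-assoc n a b)))
                      (ℤP.*-assoc (f a) (g b) (h (n ∸ a ∸ b)))

isCommutativeRing : ∀ M → IsCommutativeRing (_≈[ M ]_) _⊕_ _⊛_ ⊖_ zeroPS onePS
isCommutativeRing M = record
  { isRing = record
    { +-isAbelianGroup = record
      { isGroup = record
        { isMonoid = record
          { isSemigroup = record
            { isMagma = record
              { isEquivalence = record
                { refl  = λ n → ≡[]-refl _
                ; sym   = λ f≈g n → ≡[]-sym (f≈g n)
                ; trans = λ f≈g g≈h n → ≡[]-trans (f≈g n) (g≈h n) }
              ; ∙-cong = λ f≈f′ g≈g′ n → ≡[]-+ (f≈f′ n) (g≈g′ n) }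
            ; assoc = λ f g h → ≗⇒≈ (λ n → ℤP.+-assoc (f n) (g n) (h n)) }
          ; identity = (λ f → ≗⇒≈ (λ n → ℤP.+-identityˡ (f n))) , (λ f → ≗⇒≈ (λ n → ℤP.+-identityʳ (f n))) }
        ; inverse = (λ f → ≗⇒≈ (λ n → ℤP.+-inverseˡ (f n))) , (λ f → ≗⇒≈ (λ n → ℤP.+-inverseʳ (f n)))
        ; ⁻¹-cong = λ f≈g n → ≡[]-neg (f≈g n) }
      ; comm = λ f g → ≗⇒≈ (λ n → ℤP.+-comm (f n) (g n)) }
    ; *-cong     = ⊛-congᴹ
    ; *-assoc    = λ f g h → ≗⇒≈ (⊛-assoc f g h)
    ; *-identity = (λ f → ≗⇒≈ (⊛-identityˡ f)) , (λ f → ≗⇒≈ (⊛-identityʳ f))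
    ; distrib    = (λ f g h → ≗⇒≈ (⊛-distribˡ-⊕ f g h)) , (λ f g h → ≗⇒≈ (⊛-distribʳ-⊕ f g h)) }
  ; *-comm = λ f g → ≗⇒≈ (⊛-comm f g) }

commutativeRing : ℕ → CommutativeRing 0ℓ 0ℓ
commutativeRing M = record { isCommutativeRing = isCommutativeRing M }

module SeriesMod (M : ℕ) where

  open CommutativeRing (commutativeRing M) public
    using (*-cong; +-cong; *-assoc; *-identityˡ; *-identityʳ; +-identityˡ; +-identityʳ)
    renaming (refl to ≈-refl; sym to ≈-sym; trans to ≈-trans)
  open SemiringExp (CommutativeRing.semiring (commutativeRing M)) using (^-homo-*; ^-assocʳ) renaming (_^_ to _^ᴿ_)
  open CommutativeSemiringExp (CommutativeRing.commutativeSemiring (commutativeRing M)) using (^-distrib-*)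
  module ≈-Reasoning = SetoidReasoning (CommutativeRing.setoid (commutativeRing M))
  module ⊛-Solver = CommutativeMonoidSolver (CommutativeRing.*-commutativeMonoid (commutativeRing M))

  powPS≈^ : ∀ f e → powPS f e ≈[ M ] (f ^ᴿ e)
  powPS≈^ f zero    = ≈-refl
  powPS≈^ f (suc e) = *-cong {f} {f} {powPS f e} (≈-refl {f}) (powPS≈^ f e)

  powPS-cong : ∀ {f g} e → f ≈[ M ] g → powPS f e ≈[ M ] powPS g e
  powPS-cong zero    f≈g = ≈-refl
  powPS-cong (suc e) f≈g = *-cong f≈g (powPS-cong e f≈g)

  powPS-+ : ∀ f a b → powPS f (a + b) ≈[ M ] (powPS f a ⊛ powPS f b)
  powPS-+ f a b = ≈-trans (powPS≈^ f (a + b)) (≈-trans (^-homo-* f a b) (≈-sym (*-cong (powPS≈^ f a) (powPS≈^ f b))))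

  powPS-* : ∀ f a b → powPS (powPS f a) b ≈[ M ] powPS f (a * b)
  powPS-* f a b = ≈-trans (powPS-cong b (powPS≈^ f a))
    (≈-trans (powPS≈^ (f ^ᴿ a) b) (≈-trans (^-assocʳ f a b) (≈-sym (powPS≈^ f (a * b)))))

  powPS-distrib-⊛ : ∀ f g e → powPS (f ⊛ g) e ≈[ M ] (powPS f e ⊛ powPS g e)
  powPS-distrib-⊛ f g e =
    ≈-trans (powPS≈^ (f ⊛ g) e) (≈-trans (^-distrib-* f g e) (≈-sym (*-cong (powPS≈^ f e) (powPS≈^ g e))))

  powPS-onePS : ∀ e → powPS onePS e ≈[ M ] onePS
  powPS-onePS zero    = ≈-refl
  powPS-onePS (suc e) = ≈-trans (*-identityˡ (powPS onePS e)) (powPS-onePS e)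

  finProd-cong : ∀ N {F G} → (∀ n → F n ≈[ M ] G n) → finProd N F ≈[ M ] finProd N G
  finProd-cong zero    F≈G = ≈-refl
  finProd-cong (suc N) F≈G = *-cong (finProd-cong N F≈G) (F≈G N)

  finProd-⊛ : ∀ N F G → (finProd N F ⊛ finProd N G) ≈[ M ] finProd N (λ n → F n ⊛ G n)
  finProd-⊛ zero    F G = *-identityˡ onePS
  finProd-⊛ (suc N) F G =
    ≈-trans (prove 4 ((var 0F ∙ var 1F) ∙ (var 2F ∙ var 3F)) ((var 0F ∙ var 2F) ∙ (var 1F ∙ var 3F))
                   (finProd N F ∷ F N ∷ finProd N G ∷ G N ∷ []))
          (*-cong (finProd-⊛ N F G) (≈-refl {F N ⊛ G N}))
    where open ⊛-Solver using (prove; var) renaming (_⊕_ to _∙_)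

  finProd-ones : ∀ N F → (∀ n → n < N → F n ≈[ M ] onePS) → finProd N F ≈[ M ] onePS
  finProd-ones zero    F F≈1 = ≈-refl
  finProd-ones (suc N) F F≈1 =
    ≈-trans (*-cong (finProd-ones N F (λ n n<N → F≈1 n (ℕP.m<n⇒m<1+n n<N))) (F≈1 N ℕP.≤-refl)) (*-identityˡ onePS)

  finProd-split : ∀ a b F → finProd (a + b) F ≈[ M ] (finProd a F ⊛ finProd b (λ r → F (a + r)))
  finProd-split a zero    F rewrite ℕP.+-identityʳ a = ≈-sym (*-identityʳ (finProd a F))
  finProd-split a (suc b) F rewrite ℕP.+-suc a b =
    ≈-trans (*-cong (finProd-split a b F) (≈-refl {F (a + b)}))
          (*-assoc (finProd a F) (finProd b (λ r → F (a + r))) (F (a + b)))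

  finProd-powPS : ∀ N F e → powPS (finProd N F) e ≈[ M ] finProd N (λ n → powPS (F n) e)
  finProd-powPS zero    F e = powPS-onePS e
  finProd-powPS (suc N) F e =
    ≈-trans (powPS-distrib-⊛ (finProd N F) (F N) e) (*-cong (finProd-powPS N F e) (≈-refl {powPS (F N) e}))

if-yes : ∀ {A P : Set} (d : Dec P) {x y : A} → P → (if ⌊ d ⌋ then x else y) ≡ x
if-yes (yes _) _ = refl
if-yes (no ¬p) p = ⊥-elim (¬p p)

if-no : ∀ {A P : Set} (d : Dec P) {x y : A} → ¬ P → (if ⌊ d ⌋ then x else y) ≡ y
if-no (yes p) ¬p = ⊥-elim (¬p p)
if-no (no _)  _  = refl

monomial : ℕ → PS
monomial a i = if ⌊ i ℕ.≟ a ⌋ then ℤ.1ℤ else ℤ.0ℤ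

monomial-≢ : ∀ a i → i ≢ a → monomial a i ≡ ℤ.0ℤ
monomial-≢ a i i≢a = if-no (i ℕ.≟ a) i≢a

onePS≗monomial-0 : onePS ≗ monomial 0
onePS≗monomial-0 zero    = refl
onePS≗monomial-0 (suc n) = refl

oneMinusQ≗1⊖monomial : ∀ c → oneMinusQ c ≗ (onePS ⊕ ⊖ monomial c)
oneMinusQ≗1⊖monomial c n = refl

shiftPS : ℕ → PS → PS
shiftPS a f n = if ⌊ a ℕ.≤? n ⌋ then f (n ∸ a) else ℤ.0ℤ

shiftPS-≤ : ∀ {a n} f → a ≤ n → shiftPS a f n ≡ f (n ∸ a)
shiftPS-≤ {a} {n} f a≤n = if-yes (a ℕ.≤? n) a≤n

shiftPS-< : ∀ {a n} f → n < a → shiftPS a f n ≡ ℤ.0ℤ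
shiftPS-< {a} {n} f n<a = if-no (a ℕ.≤? n) (ℕP.<⇒≱ n<a)

sumBelow-monomial-≥ : ∀ n a (g : ℕ → ℤ) → n ≤ a → sumBelow n (λ i → monomial a i ℤ.* g i) ≡ ℤ.0ℤ
sumBelow-monomial-≥ n a g n≤a = sumBelow-zero n (λ i i<n →
  trans (cong (ℤ._* g i) (monomial-≢ a i (λ { refl → ℕP.<⇒≱ i<n n≤a }))) (ℤP.*-zeroˡ (g i)))

sumBelow-monomial-< : ∀ n a (g : ℕ → ℤ) → a < n → sumBelow n (λ i → monomial a i ℤ.* g i) ≡ g a
sumBelow-monomial-< n a g a<n = begin
    sumBelow n term
  ≡⟨ cong (λ x → sumBelow x term) (sym (ℕP.m+[n∸m]≡n a<n)) ⟩
    sumBelow (suc a + (n ∸ suc a)) term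
  ≡⟨ sumBelow-split (suc a) (n ∸ suc a) term ⟩
    (sumBelow a term ℤ.+ term a) ℤ.+ sumBelow (n ∸ suc a) (λ r → term (suc a + r))
  ≡⟨ cong₂ ℤ._+_ (cong₂ ℤ._+_ (sumBelow-monomial-≥ a a g ℕP.≤-refl) diagonal) (sumBelow-zero (n ∸ suc a) beyond) ⟩
    (ℤ.0ℤ ℤ.+ g a) ℤ.+ ℤ.0ℤ
  ≡⟨ trans (ℤP.+-identityʳ (ℤ.0ℤ ℤ.+ g a)) (ℤP.+-identityˡ (g a)) ⟩
    g a
  ∎
  where
  open ≡-Reasoning
  term : ℕ → ℤ
  term i = monomial a i ℤ.* g i
  diagonal : term a ≡ g a
  diagonal = trans (cong (ℤ._* g a) (if-yes (a ℕ.≟ a) refl)) (ℤP.*-identityˡ (g a))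
  beyond : ∀ r → r < n ∸ suc a → term (suc a + r) ≡ ℤ.0ℤ
  beyond r _ = trans (cong (ℤ._* g (suc a + r)) (monomial-≢ a (suc a + r) (λ e → ℕP.m+1+n≢m a (trans (ℕP.+-suc a r) e))))
                     (ℤP.*-zeroˡ (g (suc a + r)))

monomial-⊛ : ∀ a f → (monomial a ⊛ f) ≗ shiftPS a f
monomial-⊛ a f n with a ℕ.≤? n
... | yes a≤n = trans (sumUpTo≡sumBelow n (λ i → monomial a i ℤ.* f (n ∸ i)))
                      (sumBelow-monomial-< (suc n) a (λ i → f (n ∸ i)) (s≤s a≤n))
... | no a≰n  = trans (sumUpTo≡sumBelow n (λ i → monomial a i ℤ.* f (n ∸ i)))
                      (sumBelow-monomial-≥ (suc n) a (λ i → f (n ∸ i)) (ℕP.≰⇒> a≰n))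

monomial-⊛-monomial : ∀ a b → (monomial a ⊛ monomial b) ≗ monomial (a + b)
monomial-⊛-monomial a b n with a ℕ.≤? n
... | yes a≤n = trans (monomial-⊛ a (monomial b) n) (trans (shiftPS-≤ (monomial b) a≤n) shifted)
  where
  shifted : monomial b (n ∸ a) ≡ monomial (a + b) n
  shifted with n ∸ a ℕ.≟ b | n ℕ.≟ a + b
  ... | yes _ | yes _ = refl
  ... | no _  | no _  = refl
  ... | yes e | no ne = ⊥-elim (ne (trans (sym (ℕP.m+[n∸m]≡n a≤n)) (cong (_+_ a) e)))
  ... | no ne | yes e = ⊥-elim (ne (trans (cong (_∸ a) e) (ℕP.m+n∸m≡n a b)))
... | no a≰n = trans (monomial-⊛ a (monomial b) n) (trans (shiftPS-< (monomial b) (ℕP.≰⇒> a≰n))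
  (sym (monomial-≢ (a + b) n (λ e → a≰n (subst (a ≤_) (sym e) (ℕP.m≤m+n a b))))))

powPS-monomial : ∀ c e → powPS (monomial c) e ≗ monomial (e * c)
powPS-monomial c zero    = onePS≗monomial-0
powPS-monomial c (suc e) n =
  trans (⊛-congʳ (monomial c) (powPS-monomial c e) n) (monomial-⊛-monomial c (e * c) n)

geomQ-0 : ∀ c → geomQ c 0 ≡ ℤ.1ℤ
geomQ-0 c = if-yes (c ℕD.∣? 0) (c ℕD.∣0)

geomQ-< : ∀ c n → 0 < n → n < c → geomQ c n ≡ ℤ.0ℤ
geomQ-< c n 0<n n<c = if-no (c ℕD.∣? n) (λ c∣n → ℕP.<⇒≱ n<c (ℕD.∣⇒≤ ⦃ ℕ.>-nonZero 0<n ⦄ c∣n))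

geomQ-∸ : ∀ c n → c ≤ n → geomQ c n ≡ geomQ c (n ∸ c)
geomQ-∸ c n c≤n with c ℕD.∣? n | c ℕD.∣? (n ∸ c)
... | yes _   | yes _   = refl
... | no _    | no _    = refl
... | yes c∣n | no c∤n-c =
  ⊥-elim (c∤n-c (ℕD.∣m+n∣m⇒∣n (subst (c ℕD.∣_) (sym (ℕP.m+[n∸m]≡n c≤n)) c∣n) ℕD.∣-refl))
... | no c∤n  | yes c∣n-c = ⊥-elim (c∤n (ℕD.∣m∸n∣n⇒∣m c c≤n c∣n-c ℕD.∣-refl))

geomQ-⊖-shift : ∀ c → 1 ≤ c → (geomQ c ⊕ ⊖ shiftPS c (geomQ c)) ≗ onePS
geomQ-⊖-shift c 1≤c zero rewrite geomQ-0 c | shiftPS-< {c} {0} (geomQ c) 1≤c = refl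
geomQ-⊖-shift c 1≤c (suc n) with c ℕ.≤? suc n
... | yes c≤n rewrite geomQ-∸ c (suc n) c≤n = ℤP.+-inverseʳ (geomQ c (suc n ∸ c))
... | no c≰n  rewrite geomQ-< c (suc n) (s≤s z≤n) (ℕP.≰⇒> c≰n) = refl

oneMinusQ⊛geomQ : ∀ {M} c → 1 ≤ c → (oneMinusQ c ⊛ geomQ c) ≈[ M ] onePS
oneMinusQ⊛geomQ {M} c 1≤c = begin
    oneMinusQ c ⊛ geomQ c
  ≈⟨ ⊛-congᴹ (≗⇒≈ (oneMinusQ≗1⊖monomial c)) (≈-refl {geomQ c}) ⟩
    (onePS ⊕ ⊖ monomial c) ⊛ geomQ c
  ≈⟨ ≗⇒≈ (⊛-distribʳ-⊕ (geomQ c) onePS (⊖ monomial c)) ⟩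
    (onePS ⊛ geomQ c) ⊕ ((⊖ monomial c) ⊛ geomQ c)
  ≈⟨ +-cong (≗⇒≈ (⊛-identityˡ (geomQ c))) (≈-trans (≈-sym (-‿distribˡ-* (monomial c) (geomQ c)))
                                                   (-‿cong (≗⇒≈ (monomial-⊛ c (geomQ c))))) ⟩
    geomQ c ⊕ ⊖ shiftPS c (geomQ c)
  ≈⟨ ≗⇒≈ (geomQ-⊖-shift c 1≤c) ⟩
    onePS
  ∎
  where
  open SeriesMod M
  open ≈-Reasoning
  open CommutativeRing (commutativeRing M) using (-‿cong; ring)
  open RingProperties ring using (-‿distribˡ-*)

-- Truncations and infinite products

AgreeUpTo : ℕ → PS → PS → Set
AgreeUpTo N f g = ∀ i → i ≤ N → f i ≡ g i

AgreeUpTo-trans : ∀ {N f g h} → AgreeUpTo N f g → AgreeUpTo N g h → AgreeUpTo N f h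
AgreeUpTo-trans f≡g g≡h i i≤N = trans (f≡g i i≤N) (g≡h i i≤N)

AgreeUpTo-≤ : ∀ {N N′ f g} → N′ ≤ N → AgreeUpTo N f g → AgreeUpTo N′ f g
AgreeUpTo-≤ N′≤N f≡g i i≤N′ = f≡g i (ℕP.≤-trans i≤N′ N′≤N)

AgreeUpTo-⊛ : ∀ {N} f {f′} g {g′} → AgreeUpTo N f f′ → AgreeUpTo N g g′ → AgreeUpTo N (f ⊛ g) (f′ ⊛ g′)
AgreeUpTo-⊛ f g f≡f′ g≡g′ i i≤N = sumUpTo-cong i (λ j j≤i →
  cong₂ ℤ._*_ (f≡f′ j (ℕP.≤-trans j≤i i≤N)) (g≡g′ (i ∸ j) (ℕP.≤-trans (ℕP.m∸n≤m i j) i≤N)))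

AgreeUpTo-powPS : ∀ {N} f {g} e → AgreeUpTo N f g → AgreeUpTo N (powPS f e) (powPS g e)
AgreeUpTo-powPS f zero    f≡g i _ = refl
AgreeUpTo-powPS f (suc e) f≡g = AgreeUpTo-⊛ f (powPS f e) f≡g (AgreeUpTo-powPS f e f≡g)

≈-from-truncations : ∀ {M f g} (f≤ g≤ : ℕ → PS) → (∀ n → AgreeUpTo n f (f≤ n)) → (∀ n → AgreeUpTo n g (g≤ n)) →
                     (∀ n → f≤ n ≈[ M ] g≤ n) → f ≈[ M ] g
≈-from-truncations f≤ g≤ f≡f≤ g≡g≤ f≤≈g≤ n =
  subst₂ (_≡[ _ ]_) (sym (f≡f≤ n n ℕP.≤-refl)) (sym (g≡g≤ n n ℕP.≤-refl)) (f≤≈g≤ n n)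

-- When F n ≡ 1 up to degree n, the coefficient of q^N in ∏ F is that of its first N factors.
OneUpToIndex : (ℕ → PS) → Set
OneUpToIndex F = ∀ n → AgreeUpTo n (F n) onePS

finProd-+-agree : ∀ F → OneUpToIndex F → ∀ i d → AgreeUpTo i (finProd (i + d) F) (finProd i F)
finProd-+-agree F F≈1 i zero rewrite ℕP.+-identityʳ i = λ _ _ → refl
finProd-+-agree F F≈1 i (suc d) rewrite ℕP.+-suc i d =
  AgreeUpTo-trans (AgreeUpTo-⊛ (finProd (i + d) F) (F (i + d)) (λ _ _ → refl) (AgreeUpTo-≤ (ℕP.m≤m+n i d) (F≈1 (i + d))))
    (AgreeUpTo-trans (λ j _ → ⊛-identityʳ (finProd (i + d) F) j) (finProd-+-agree F F≈1 i d))

finProd-stable : ∀ F → OneUpToIndex F → ∀ {i N} → i ≤ N → finProd N F i ≡ finProd i F i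
finProd-stable F F≈1 {i} i≤N =
  subst (λ N → finProd N F i ≡ finProd i F i) (ℕP.m+[n∸m]≡n i≤N) (finProd-+-agree F F≈1 i (_ ∸ i) i ℕP.≤-refl)

finProd-stable-agree : ∀ F → OneUpToIndex F → ∀ N → AgreeUpTo N (λ i → finProd i F i) (finProd N F)
finProd-stable-agree F F≈1 N i i≤N = sym (finProd-stable F F≈1 i≤N)

oneMinusQ-agree : ∀ c n → n < c → AgreeUpTo n (oneMinusQ c) onePS
oneMinusQ-agree c n n<c i i≤n =
  trans (cong (λ x → onePS i ℤ.+ ℤ.- x) (monomial-≢ c i (ℕP.<⇒≢ (ℕP.≤-<-trans i≤n n<c)))) (ℤP.+-identityʳ (onePS i))

geomQ-agree : ∀ c n → n < c → AgreeUpTo n (geomQ c) onePS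
geomQ-agree c n n<c zero    _   = geomQ-0 c
geomQ-agree c n n<c (suc i) i≤n = geomQ-< c (suc i) (s≤s z≤n) (ℕP.≤-<-trans i≤n n<c)

eulerFactor : ℕ → ℕ → PS
eulerFactor a n = oneMinusQ (a * suc n)

eulerFactorInv : ℕ → ℕ → PS
eulerFactorInv a n = geomQ (a * suc n)

n<a*[1+n] : ∀ a n → 1 ≤ a → n < a * suc n
n<a*[1+n] a n 1≤a = ℕP.<-≤-trans (ℕP.n<1+n n) (subst (_≤ a * suc n) (ℕP.*-identityˡ (suc n)) (ℕP.*-monoˡ-≤ (suc n) 1≤a))

eulerProd-agree : ∀ a → 1 ≤ a → ∀ N → AgreeUpTo N (eulerProd a) (finProd N (eulerFactor a))
eulerProd-agree a 1≤a = finProd-stable-agree (eulerFactor a) (λ n → oneMinusQ-agree (a * suc n) n (n<a*[1+n] a n 1≤a))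

eulerProdInv-agree : ∀ a → 1 ≤ a → ∀ N → AgreeUpTo N (eulerProdInv a) (finProd N (eulerFactorInv a))
eulerProdInv-agree a 1≤a = finProd-stable-agree (eulerFactorInv a) (λ n → geomQ-agree (a * suc n) n (n<a*[1+n] a n 1≤a))

eulerProd⊛eulerProdInv : ∀ {M} a → 1 ≤ a → (eulerProd a ⊛ eulerProdInv a) ≈[ M ] onePS
eulerProd⊛eulerProdInv {M} a 1≤a =
  ≈-from-truncations (λ n → finProd n (eulerFactor a) ⊛ finProd n (eulerFactorInv a)) (λ _ → onePS)
  (λ n → AgreeUpTo-⊛ (eulerProd a) (eulerProdInv a) (eulerProd-agree a 1≤a n) (eulerProdInv-agree a 1≤a n))
  (λ _ _ _ → refl)
  (λ n → ≈-trans (finProd-⊛ n (eulerFactor a) (eulerFactorInv a))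
                 (finProd-ones n _ (λ i _ → oneMinusQ⊛geomQ (a * suc i) (ℕP.≤-trans (s≤s z≤n) (n<a*[1+n] a i 1≤a)))))
  where open SeriesMod M

-- Binomial coefficients and the Frobenius congruence

C-absorption : ∀ n k → suc k * (suc n C suc k) ≡ suc n * (n C k)
C-absorption zero zero = refl
C-absorption zero (suc k)
  rewrite k>n⇒nCk≡0 {1} {suc (suc k)} (s≤s (s≤s z≤n)) | k>n⇒nCk≡0 {0} {suc k} (s≤s z≤n) = ℕP.*-zeroʳ (suc (suc k))
C-absorption (suc n) zero rewrite sym (nCk+nC[k+1]≡[n+1]C[k+1] (suc n) 0) | nC1≡n (suc n) =
  cong (λ x → suc (suc x)) (trans (ℕP.+-identityʳ n) (sym (ℕP.*-identityʳ n)))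
C-absorption (suc n) (suc k) = begin
    suc (suc k) * (suc (suc n) C suc (suc k))
  ≡⟨ cong (suc (suc k) *_) (sym (nCk+nC[k+1]≡[n+1]C[k+1] (suc n) (suc k))) ⟩
    suc (suc k) * (a + b)
  ≡⟨ distribute k a b ⟩
    a + suc k * a + suc (suc k) * b
  ≡⟨ cong₂ (λ x y → a + x + y) (C-absorption n k) (C-absorption n (suc k)) ⟩
    a + suc n * (n C k) + suc n * (n C suc k)
  ≡⟨ collect a n (n C k) (n C suc k) ⟩
    a + suc n * (n C k + n C suc k)
  ≡⟨ cong (_+ suc n * (n C k + n C suc k)) (sym (nCk+nC[k+1]≡[n+1]C[k+1] n k)) ⟩
    suc (suc n) * (n C k + n C suc k)
  ≡⟨ cong (suc (suc n) *_) (nCk+nC[k+1]≡[n+1]C[k+1] n k) ⟩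
    suc (suc n) * (suc n C suc k)
  ∎
  where
  open ≡-Reasoning
  a = suc n C suc k
  b = suc n C suc (suc k)
  distribute : ∀ k a b → suc (suc k) * (a + b) ≡ a + suc k * a + suc (suc k) * b
  distribute = ℕSolver.solve-∀
  collect : ∀ a n x y → a + suc n * x + suc n * y ≡ a + suc n * (x + y)
  collect = ℕSolver.solve-∀

prime∣C : ∀ {p k} → Prime p → 0 < k → k < p → p ℕD.∣ (p C k)
prime∣C {zero}  pp = ⊥-elim (NonZero.nonZero (prime⇒nonZero pp))
prime∣C {suc n} {suc k} pp _ k<p
  with euclidsLemma (suc k) (suc n C suc k) pp (subst (suc n ℕD.∣_) (sym (C-absorption n k)) (ℕD.m∣m*n (n C k)))
... | inj₁ p∣k = ⊥-elim (ℕP.<⇒≱ k<p (ℕD.∣⇒≤ p∣k))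
... | inj₂ p∣C = p∣C

infix 4 _∣ₛ_
_∣ₛ_ : ℕ → PS → Set
a ∣ₛ f = ∀ n → (+ a) ℤD.∣ f n

∣ₛ⇒≈0 : ∀ {a f} → a ∣ₛ f → f ≈[ a ] zeroPS
∣ₛ⇒≈0 a∣f n = ≡[]-0 (a∣f n)

∣ₛ-⊛ˡ : ∀ {a} f g → a ∣ₛ f → a ∣ₛ (f ⊛ g)
∣ₛ-⊛ˡ f g a∣f n = sumUpTo-∣ n (λ i → f i ℤ.* g (n ∸ i)) (λ i → ℤD.∣m⇒∣m*n (g (n ∸ i)) (a∣f i))

∣ₛ-⊛ : ∀ {a b} f g → a ∣ₛ f → b ∣ₛ g → (a * b) ∣ₛ (f ⊛ g)
∣ₛ-⊛ f g a∣f b∣g n = sumUpTo-∣ n (λ i → f i ℤ.* g (n ∸ i)) (λ i → *-∣-* (a∣f i) (b∣g (n ∸ i)))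

∣ₛ-∣ : ∀ {a b f} → a ℕD.∣ b → b ∣ₛ f → a ∣ₛ f
∣ₛ-∣ a∣b b∣f n = ℤD.∣-trans (ℤD.∣ᵤ⇒∣ a∣b) (b∣f n)

module Binomials (M : ℕ) where

  open SeriesMod M
  open CommutativeRing (commutativeRing M) using (commutativeSemiring; semiring; +-monoid; +-comm)
  open SemiringExp semiring using () renaming (_^_ to _^ᴿ_)
  open SemiringMult semiring using (_×_)
  open MonoidSum +-monoid using (sum)
  open Binomial commutativeSemiring using (theorem; binomialTerm)

  ×-coefficient : ∀ c z i → (c × z) i ≡ + c ℤ.* z i
  ×-coefficient zero    z i = refl
  ×-coefficient (suc c) z i = begin
      z i ℤ.+ (c × z) i
    ≡⟨ cong (ℤ._+_ (z i)) (×-coefficient c z i) ⟩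
      z i ℤ.+ + c ℤ.* z i
    ≡⟨ cong (ℤ._+ (+ c ℤ.* z i)) (sym (ℤP.*-identityˡ (z i))) ⟩
      ℤ.1ℤ ℤ.* z i ℤ.+ + c ℤ.* z i
    ≡⟨ sym (ℤP.*-distribʳ-+ (z i) (+ 1) (+ c)) ⟩
      + suc c ℤ.* z i
    ∎
    where open ≡-Reasoning

  sum-only-last : ∀ q (u : Fin (suc q) → PS) → (∀ i → toℕ i ≢ q → u i ≈[ M ] zeroPS) → sum u ≈[ M ] u (fromℕ q)
  sum-only-last zero    u u≈0 = +-identityʳ (u fzero)
  sum-only-last (suc q) u u≈0 = ≈-trans
    (+-cong (u≈0 fzero (λ ())) (sum-only-last q (tail u) (λ i i≢q → u≈0 (fsuc i) (λ e → i≢q (ℕP.suc-injective e)))))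
    (+-identityˡ (u (fsuc (fromℕ q))))

  powPS-⊕-no-middle-terms : ∀ q x y →
    (∀ k → 0 < k → k < suc q → ∀ n → (+ M) ℤD.∣ (+ (suc q C k) ℤ.* (powPS x k ⊛ powPS y (suc q ∸ k)) n)) →
    powPS (x ⊕ y) (suc q) ≈[ M ] (powPS x (suc q) ⊕ powPS y (suc q))
  powPS-⊕-no-middle-terms q x y middle = begin
      powPS (x ⊕ y) p
    ≈⟨ powPS≈^ (x ⊕ y) p ⟩
      (x ⊕ y) ^ᴿ p
    ≈⟨ theorem p x y ⟩
      term fzero ⊕ sum (tail term)
    ≈⟨ +-cong first (≈-trans (sum-only-last q (tail term) middle-vanishes) last) ⟩
      (y ^ᴿ p) ⊕ (x ^ᴿ p)
    ≈⟨ +-comm (y ^ᴿ p) (x ^ᴿ p) ⟩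
      (x ^ᴿ p) ⊕ (y ^ᴿ p)
    ≈⟨ ≈-sym (+-cong (powPS≈^ x p) (powPS≈^ y p)) ⟩
      powPS x p ⊕ powPS y p
    ∎
    where
    open ≈-Reasoning
    p = suc q
    term = binomialTerm x y p
    first : term fzero ≈[ M ] (y ^ᴿ p)
    first = ≈-trans (+-identityʳ (onePS ⊛ (y ^ᴿ p))) (*-identityˡ (y ^ᴿ p))
    last : term (fsuc (fromℕ q)) ≈[ M ] (x ^ᴿ p)
    last rewrite FinP.toℕ-fromℕ q | nCn≡1 p | ℕP.n∸n≡0 q =
      ≈-trans (+-identityʳ ((x ^ᴿ p) ⊛ onePS)) (*-identityʳ (x ^ᴿ p))
    middle-vanishes : ∀ i → toℕ i ≢ q → term (fsuc i) ≈[ M ] zeroPS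
    middle-vanishes i i≢q n = ≡[]-trans (≡[]-reflexive (×-coefficient (p C k) _ n))
      (≡[]-trans (≡[]-* (≡[]-refl (+ (p C k))) (*-cong (≈-sym (powPS≈^ x k)) (≈-sym (powPS≈^ y (p ∸ k))) n))
                 (≡[]-0 (middle k (s≤s z≤n) (s≤s (ℕP.≤∧≢⇒< (ℕP.≤-pred (FinP.toℕ<n i)) i≢q)) n)))
      where k = suc (toℕ i)

frobenius : ∀ {p} → Prime p → ∀ x y → powPS (x ⊕ y) p ≈[ p ] (powPS x p ⊕ powPS y p)
frobenius {zero}  pp = ⊥-elim (NonZero.nonZero (prime⇒nonZero pp))
frobenius {suc q} pp x y = Binomials.powPS-⊕-no-middle-terms (suc q) q x y
  (λ k 0<k k<p n → ℤD.∣m⇒∣m*n ((powPS x k ⊛ powPS y (suc q ∸ k)) n)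
                                (ℤD.∣ᵤ⇒∣ {+ suc q} {+ (suc q C k)} (prime∣C pp 0<k k<p)))

module _ {p : ℕ} (pp : Prime p) where

  open SeriesMod p
  open CommutativeRing (commutativeRing p) using (-‿cong; +-group; zeroˡ; -‿inverseʳ)
  open GroupProperties +-group using (inverseʳ-unique)

  powPS-⊖ : ∀ x → powPS (⊖ x) p ≈[ p ] (⊖ powPS x p)
  powPS-⊖ x = inverseʳ-unique (powPS x p) (powPS (⊖ x) p)
    (≈-trans (≈-sym (frobenius pp x (⊖ x)))
             (≈-trans (powPS-cong p (-‿inverseʳ x))
                      (subst (λ e → powPS zeroPS e ≈[ p ] zeroPS) (ℕP.suc-pred p {{prime⇒nonZero pp}})
                             (zeroˡ (powPS zeroPS (ℕ.pred p))))))

  oneMinusQ-frobenius : ∀ c → powPS (oneMinusQ c) p ≈[ p ] oneMinusQ (p * c)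
  oneMinusQ-frobenius c = begin
      powPS (oneMinusQ c) p
    ≈⟨ powPS-cong p (≗⇒≈ (oneMinusQ≗1⊖monomial c)) ⟩
      powPS (onePS ⊕ ⊖ monomial c) p
    ≈⟨ frobenius pp onePS (⊖ monomial c) ⟩
      powPS onePS p ⊕ powPS (⊖ monomial c) p
    ≈⟨ +-cong (powPS-onePS p) (≈-trans (powPS-⊖ (monomial c)) (-‿cong (≗⇒≈ (powPS-monomial c p)))) ⟩
      oneMinusQ (p * c)
    ∎
    where open ≈-Reasoning

  eulerProd-frobenius : ∀ a → 1 ≤ a → powPS (eulerProd a) p ≈[ p ] eulerProd (a * p)
  eulerProd-frobenius a 1≤a =
    ≈-from-truncations (λ n → powPS (finProd n (eulerFactor a)) p) (λ n → finProd n (eulerFactor (a * p)))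
      (λ n → AgreeUpTo-powPS (eulerProd a) p (eulerProd-agree a 1≤a n))
      (eulerProd-agree (a * p) (ℕP.*-mono-≤ 1≤a (ℕ.>-nonZero⁻¹ p {{prime⇒nonZero pp}})))
      (λ n → ≈-trans (finProd-powPS n (eulerFactor a) p)
                     (finProd-cong n (λ i → ≈-trans (oneMinusQ-frobenius (a * suc i))
                                                     (≗⇒≈ (λ x → cong (λ c → oneMinusQ c x) (rearrange i))))))
    where
    rearrange : ∀ i → p * (a * suc i) ≡ a * p * suc i
    rearrange i = solve p a i
      where solve : ∀ p a i → p * (a * suc i) ≡ a * p * suc i
            solve = ℕSolver.solve-∀

-- With F = D + G and p^{i+1} ∣ D, each middle binomial term gains a factor p from p C k,
-- and D^p is divisible by p^{2(i+1)}.
powPS-lift : ∀ {p i F G} → Prime p → F ≈[ p ^ suc i ] G → powPS F p ≈[ p ^ suc (suc i) ] powPS G p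
powPS-lift {zero}        pp = ⊥-elim (NonZero.nonZero (prime⇒nonZero pp))
powPS-lift {suc zero}    pp = ⊥-elim (NonTrivial.nonTrivial (prime⇒nonTrivial pp))
powPS-lift {p@(suc (suc q′))} {i} {F} {G} pp F≈G = begin
    powPS F p
  ≈⟨ powPS-cong p (≗⇒≈ F≗D⊕G) ⟩
    powPS (D ⊕ G) p
  ≈⟨ powPS-⊕-no-middle-terms (suc q′) D G middle ⟩
    powPS D p ⊕ powPS G p
  ≈⟨ +-cong (∣ₛ⇒≈0 (∣ₛ-∣ p^[2+i]∣p^[1+i]² D^p-div)) (≈-refl {powPS G p}) ⟩
    zeroPS ⊕ powPS G p
  ≈⟨ +-identityˡ (powPS G p) ⟩
    powPS G p
  ∎
  where
  open SeriesMod (p ^ suc (suc i))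
  open Binomials (p ^ suc (suc i))
  open ≈-Reasoning
  D = F ⊕ ⊖ G
  D-div : p ^ suc i ∣ₛ D
  D-div n = divides-difference (F≈G n)
  F≗D⊕G : F ≗ (D ⊕ G)
  F≗D⊕G n = regroup (F n) (G n)
    where
    regroup : ∀ a b → a ≡ (a ℤ.+ ℤ.- b) ℤ.+ b
    regroup = solve-∀
  middle : ∀ k → 0 < k → k < p → ∀ n → (+ (p ^ suc (suc i))) ℤD.∣ (+ (p C k) ℤ.* (powPS D k ⊛ powPS G (p ∸ k)) n)
  middle (suc k) _ k<p n = *-∣-* (ℤD.∣ᵤ⇒∣ {+ p} {+ (p C suc k)} (prime∣C pp (s≤s z≤n) k<p))
                                 (∣ₛ-⊛ˡ (powPS D (suc k)) (powPS G (p ∸ suc k)) (∣ₛ-⊛ˡ D (powPS D k) D-div) n)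
  D^p-div : (p ^ suc i * p ^ suc i) ∣ₛ powPS D p
  D^p-div = ∣ₛ-⊛ D (D ⊛ powPS D q′) D-div (∣ₛ-⊛ˡ D (powPS D q′) D-div)
  p^[2+i]∣p^[1+i]² : p ^ suc (suc i) ℕD.∣ p ^ suc i * p ^ suc i
  p^[2+i]∣p^[1+i]² = subst (p ^ suc (suc i) ℕD.∣_) (regroup p (p ^ i)) (ℕD.m∣m*n (p ^ i))
    where
    regroup : ∀ p x → (p * (p * x)) * x ≡ (p * x) * (p * x)
    regroup = ℕSolver.solve-∀

eulerProd-prime-power : ∀ {p} → Prime p → ∀ a → 1 ≤ a → ∀ i →
  powPS (eulerProd a) (p ^ suc i) ≈[ p ^ suc i ] powPS (eulerProd (a * p)) (p ^ i)
eulerProd-prime-power {p} pp a 1≤a zero =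
  subst (λ x → powPS (eulerProd a) x ≈[ x ] powPS (eulerProd (a * p)) 1) (sym (ℕP.*-identityʳ p))
    (≈-trans (eulerProd-frobenius pp a 1≤a) (≈-sym (*-identityʳ (eulerProd (a * p)))))
  where open SeriesMod p
eulerProd-prime-power {p} pp a 1≤a (suc i) = begin
    powPS (eulerProd a) (p ^ suc (suc i))
  ≡⟨ cong (powPS (eulerProd a)) (ℕP.*-comm p (p ^ suc i)) ⟩
    powPS (eulerProd a) (p ^ suc i * p)
  ≈⟨ ≈-sym (powPS-* (eulerProd a) (p ^ suc i) p) ⟩
    powPS (powPS (eulerProd a) (p ^ suc i)) p
  ≈⟨ powPS-lift {i = i} pp (eulerProd-prime-power pp a 1≤a i) ⟩
    powPS (powPS (eulerProd (a * p)) (p ^ i)) p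
  ≈⟨ powPS-* (eulerProd (a * p)) (p ^ i) p ⟩
    powPS (eulerProd (a * p)) (p ^ i * p)
  ≡⟨ cong (powPS (eulerProd (a * p))) (ℕP.*-comm (p ^ i) p) ⟩
    powPS (eulerProd (a * p)) (p ^ suc i)
  ∎
  where
  open SeriesMod (p ^ suc (suc i))
  open ≈-Reasoning

-- Dilation q ↦ q^d

module Dilation (d : ℕ) .{{_ : NonZero d}} where

  dilate : PS → PS
  dilate f n = if ⌊ d ℕD.∣? n ⌋ then f (n / d) else ℤ.0ℤ

  dilate-* : ∀ f t → dilate f (d * t) ≡ f t
  dilate-* f t = trans (if-yes (d ℕD.∣? (d * t)) (ℕD.m∣m*n t))
                       (cong f (trans (cong (_/ d) (ℕP.*-comm d t)) (m*n/n≡m t d)))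

  dilate-∤ : ∀ f n → ¬ (d ℕD.∣ n) → dilate f n ≡ ℤ.0ℤ
  dilate-∤ f n d∤n = if-no (d ℕD.∣? n) d∤n

  multiple-or-∤ : ∀ (P : ℕ → Set) → (∀ t → P (d * t)) → (∀ n → ¬ (d ℕD.∣ n) → P n) → ∀ n → P n
  multiple-or-∤ P multiple ∤ n with d ℕD.∣? n
  ... | yes (ℕD.divides t n≡t*d) = subst P (sym (trans n≡t*d (ℕP.*-comm t d))) (multiple t)
  ... | no d∤n = ∤ n d∤n

  dilate-cong : ∀ {f g} → f ≗ g → dilate f ≗ dilate g
  dilate-cong f≗g n with d ℕD.∣? n
  ... | yes _ = f≗g (n / d)
  ... | no _  = refl

  dilate-⊕ : ∀ f g → dilate (f ⊕ g) ≗ (dilate f ⊕ dilate g)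
  dilate-⊕ f g n with d ℕD.∣? n
  ... | yes _ = refl
  ... | no _  = refl

  dilate-⊖ : ∀ f → dilate (⊖ f) ≗ (⊖ dilate f)
  dilate-⊖ f n with d ℕD.∣? n
  ... | yes _ = refl
  ... | no _  = refl

  dilate-geomQ : ∀ c → dilate (geomQ c) ≗ geomQ (d * c)
  dilate-geomQ c = multiple-or-∤ (λ n → dilate (geomQ c) n ≡ geomQ (d * c) n)
    (λ t → trans (dilate-* (geomQ c) t) (at-multiple t))
    (λ n d∤n → trans (dilate-∤ (geomQ c) n d∤n)
                     (sym (if-no ((d * c) ℕD.∣? n) (λ dc∣n → d∤n (ℕD.m*n∣⇒m∣ d c dc∣n)))))
    where
    at-multiple : ∀ t → geomQ c t ≡ geomQ (d * c) (d * t)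
    at-multiple t with c ℕD.∣? t | (d * c) ℕD.∣? (d * t)
    ... | yes _   | yes _    = refl
    ... | no _    | no _     = refl
    ... | yes c∣t | no dc∤dt = ⊥-elim (dc∤dt (ℕD.*-monoʳ-∣ d c∣t))
    ... | no c∤t  | yes dc∣dt = ⊥-elim (c∤t (ℕD.*-cancelˡ-∣ d dc∣dt))

  dilate-monomial : ∀ a → dilate (monomial a) ≗ monomial (d * a)
  dilate-monomial a = multiple-or-∤ (λ n → dilate (monomial a) n ≡ monomial (d * a) n)
    (λ t → trans (dilate-* (monomial a) t) (at-multiple t))
    (λ n d∤n → trans (dilate-∤ (monomial a) n d∤n)
                     (sym (monomial-≢ (d * a) n (λ e → d∤n (subst (d ℕD.∣_) (sym e) (ℕD.m∣m*n a))))))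
    where
    at-multiple : ∀ t → monomial a t ≡ monomial (d * a) (d * t)
    at-multiple t with t ℕ.≟ a | d * t ℕ.≟ d * a
    ... | yes _   | yes _     = refl
    ... | no _    | no _      = refl
    ... | yes t≡a | no dt≢da  = ⊥-elim (dt≢da (cong (d *_) t≡a))
    ... | no t≢a  | yes dt≡da = ⊥-elim (t≢a (ℕP.*-cancelˡ-≡ t a d dt≡da))

  dilate-onePS : dilate onePS ≗ onePS
  dilate-onePS n = trans (dilate-cong onePS≗monomial-0 n)
    (trans (dilate-monomial 0 n) (trans (cong (λ x → monomial x n) (ℕP.*-zeroʳ d)) (sym (onePS≗monomial-0 n))))

  dilate-oneMinusQ : ∀ c → dilate (oneMinusQ c) ≗ oneMinusQ (d * c)
  dilate-oneMinusQ c n = trans (dilate-⊕ onePS (⊖ monomial c) n)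
    (cong₂ ℤ._+_ (dilate-onePS n) (trans (dilate-⊖ (monomial c) n) (cong ℤ.-_ (dilate-monomial c n))))

  sumBelow-dilate-block : ∀ N h (G : ℕ → ℤ) →
    sumBelow d (λ r → dilate h (d * N + r) ℤ.* G (d * N + r)) ≡ h N ℤ.* G (d * N)
  sumBelow-dilate-block N h G = begin
      sumBelow d term
    ≡⟨ cong (λ x → sumBelow x term) (sym (ℕP.suc-pred d)) ⟩
      sumBelow (suc (ℕ.pred d)) term
    ≡⟨ sumBelow-head (ℕ.pred d) term ⟩
      term 0 ℤ.+ sumBelow (ℕ.pred d) (λ r → term (suc r))
    ≡⟨ cong₂ ℤ._+_ first (sumBelow-zero (ℕ.pred d) rest) ⟩
      h N ℤ.* G (d * N) ℤ.+ ℤ.0ℤ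
    ≡⟨ ℤP.+-identityʳ _ ⟩
      h N ℤ.* G (d * N)
    ∎
    where
    open ≡-Reasoning
    term : ℕ → ℤ
    term r = dilate h (d * N + r) ℤ.* G (d * N + r)
    first : term 0 ≡ h N ℤ.* G (d * N)
    first rewrite ℕP.+-identityʳ (d * N) = cong (ℤ._* G (d * N)) (dilate-* h N)
    rest : ∀ r → r < ℕ.pred d → term (suc r) ≡ ℤ.0ℤ
    rest r r<d-1 = trans (cong (ℤ._* G (d * N + suc r)) (dilate-∤ h (d * N + suc r) d∤)) (ℤP.*-zeroˡ (G (d * N + suc r)))
      where
      d∤ : ¬ (d ℕD.∣ d * N + suc r)
      d∤ d∣ = ℕP.<⇒≱ (subst (suc r <_) (ℕP.suc-pred d) (s≤s r<d-1))
                     (ℕD.∣⇒≤ (ℕD.∣m+n∣m⇒∣n d∣ (ℕD.m∣m*n N)))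

  sumBelow-dilate : ∀ N h (G : ℕ → ℤ) →
    sumBelow (d * N) (λ i → dilate h i ℤ.* G i) ≡ sumBelow N (λ t → h t ℤ.* G (d * t))
  sumBelow-dilate zero    h G = cong (λ x → sumBelow x (λ i → dilate h i ℤ.* G i)) (ℕP.*-zeroʳ d)
  sumBelow-dilate (suc N) h G = begin
      sumBelow (d * suc N) term
    ≡⟨ cong (λ x → sumBelow x term) (trans (ℕP.*-suc d N) (ℕP.+-comm d (d * N))) ⟩
      sumBelow (d * N + d) term
    ≡⟨ sumBelow-split (d * N) d term ⟩
      sumBelow (d * N) term ℤ.+ sumBelow d (λ r → term (d * N + r))
    ≡⟨ cong₂ ℤ._+_ (sumBelow-dilate N h G) (sumBelow-dilate-block N h G) ⟩
      sumBelow (suc N) (λ t → h t ℤ.* G (d * t))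
    ∎
    where
    open ≡-Reasoning
    term : ℕ → ℤ
    term i = dilate h i ℤ.* G i

  ⊛-dilate : ∀ g h n → (g ⊛ dilate h) (d * n) ≡ ((λ t → g (d * t)) ⊛ h) n
  ⊛-dilate g h n = begin
      (g ⊛ dilate h) (d * n)
    ≡⟨ ⊛-comm g (dilate h) (d * n) ⟩
      sumUpTo (d * n) term
    ≡⟨ sumUpTo≡sumBelow (d * n) term ⟩
      sumBelow (d * n) term ℤ.+ term (d * n)
    ≡⟨ cong₂ ℤ._+_ (sumBelow-dilate n h (λ i → g (d * n ∸ i))) (cong (ℤ._* g (d * n ∸ d * n)) (dilate-* h n)) ⟩
      sumBelow (suc n) (λ t → h t ℤ.* g (d * n ∸ d * t))
    ≡⟨ sumBelow-cong (suc n) (λ t _ → cong (λ x → h t ℤ.* g x) (sym (ℕP.*-distribˡ-∸ d n t))) ⟩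
      sumBelow (suc n) (λ t → h t ℤ.* g (d * (n ∸ t)))
    ≡⟨ sym (sumUpTo≡sumBelow n (λ t → h t ℤ.* g (d * (n ∸ t)))) ⟩
      (h ⊛ (λ t → g (d * t))) n
    ≡⟨ ⊛-comm h (λ t → g (d * t)) n ⟩
      ((λ t → g (d * t)) ⊛ h) n
    ∎
    where
    open ≡-Reasoning
    term : ℕ → ℤ
    term i = dilate h i ℤ.* g (d * n ∸ i)

  dilate-⊛ : ∀ f g → dilate (f ⊛ g) ≗ (dilate f ⊛ dilate g)
  dilate-⊛ f g = multiple-or-∤ (λ n → dilate (f ⊛ g) n ≡ (dilate f ⊛ dilate g) n) at-multiple at-∤
    where
    at-multiple : ∀ t → dilate (f ⊛ g) (d * t) ≡ (dilate f ⊛ dilate g) (d * t)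
    at-multiple t = begin
        dilate (f ⊛ g) (d * t)
      ≡⟨ dilate-* (f ⊛ g) t ⟩
        (f ⊛ g) t
      ≡⟨ ⊛-comm f g t ⟩
        (g ⊛ f) t
      ≡⟨ sym (trans (⊛-dilate (dilate g) f t) (⊛-congˡ f (dilate-* g) t)) ⟩
        (dilate g ⊛ dilate f) (d * t)
      ≡⟨ ⊛-comm (dilate g) (dilate f) (d * t) ⟩
        (dilate f ⊛ dilate g) (d * t)
      ∎
      where open ≡-Reasoning
    at-∤ : ∀ n → ¬ (d ℕD.∣ n) → dilate (f ⊛ g) n ≡ (dilate f ⊛ dilate g) n
    at-∤ n d∤n = trans (dilate-∤ (f ⊛ g) n d∤n)
      (sym (trans (sumUpTo≡sumBelow n _) (sumBelow-zero (suc n) term-zero)))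
      where
      term-zero : ∀ i → i < suc n → dilate f i ℤ.* dilate g (n ∸ i) ≡ ℤ.0ℤ
      term-zero i (s≤s i≤n) with d ℕD.∣? i | d ℕD.∣? (n ∸ i)
      ... | no _    | _         = ℤP.*-zeroˡ (dilate g (n ∸ i))
      ... | yes _   | no _      = ℤP.*-zeroʳ (f (i / d))
      ... | yes d∣i | yes d∣n-i = ⊥-elim (d∤n (ℕD.∣m∸n∣n⇒∣m d i≤n d∣n-i d∣i))

  dilate-finProd : ∀ N F → dilate (finProd N F) ≗ finProd N (λ n → dilate (F n))
  dilate-finProd zero    F = dilate-onePS
  dilate-finProd (suc N) F n =
    trans (dilate-⊛ (finProd N F) (F N) n) (⊛-congˡ (dilate (F N)) (dilate-finProd N F) n)

  dilate-powPS : ∀ f e → dilate (powPS f e) ≗ powPS (dilate f) e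
  dilate-powPS f zero    = dilate-onePS
  dilate-powPS f (suc e) n = trans (dilate-⊛ f (powPS f e) n) (⊛-congʳ (dilate f) (dilate-powPS f e) n)

  dilate-agree : ∀ {N f g} → AgreeUpTo N f g → AgreeUpTo N (dilate f) (dilate g)
  dilate-agree f≡g i i≤N with d ℕD.∣? i
  ... | yes _ = f≡g (i / d) (ℕP.≤-trans (m/n≤m i d) i≤N)
  ... | no _  = refl

  dilate-finProd-stable : ∀ {F G} → OneUpToIndex F → OneUpToIndex G → (∀ n → dilate (F n) ≗ G n) →
                          dilate (λ N → finProd N F N) ≗ (λ N → finProd N G N)
  dilate-finProd-stable {F} {G} F≈1 G≈1 dF≗G N = begin
      dilate (λ i → finProd i F i) N
    ≡⟨ dilate-agree (finProd-stable-agree F F≈1 N) N ℕP.≤-refl ⟩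
      dilate (finProd N F) N
    ≡⟨ dilate-finProd N F N ⟩
      finProd N (λ n → dilate (F n)) N
    ≡⟨ ≈[0]⇒≗ (SeriesMod.finProd-cong 0 N (λ n → ≗⇒≈ (dF≗G n))) N ⟩
      finProd N G N
    ∎
    where open ≡-Reasoning

  dilate-eulerProd : ∀ a → 1 ≤ a → dilate (eulerProd a) ≗ eulerProd (d * a)
  dilate-eulerProd a 1≤a = dilate-finProd-stable
    (λ n → oneMinusQ-agree (a * suc n) n (n<a*[1+n] a n 1≤a))
    (λ n → oneMinusQ-agree (d * a * suc n) n (n<a*[1+n] (d * a) n 1≤da))
    (λ n i → trans (dilate-oneMinusQ (a * suc n) i) (cong (λ c → oneMinusQ c i) (sym (ℕP.*-assoc d a (suc n)))))
    where 1≤da = ℕP.*-mono-≤ (ℕ.>-nonZero⁻¹ d) 1≤a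

  dilate-eulerProdInv : ∀ a → 1 ≤ a → dilate (eulerProdInv a) ≗ eulerProdInv (d * a)
  dilate-eulerProdInv a 1≤a = dilate-finProd-stable
    (λ n → geomQ-agree (a * suc n) n (n<a*[1+n] a n 1≤a))
    (λ n → geomQ-agree (d * a * suc n) n (n<a*[1+n] (d * a) n 1≤da))
    (λ n i → trans (dilate-geomQ (a * suc n) i) (cong (λ c → geomQ c i) (sym (ℕP.*-assoc d a (suc n)))))
    where 1≤da = ℕP.*-mono-≤ (ℕ.>-nonZero⁻¹ d) 1≤a

-- The generating function of b_k

bkSeries : ℕ → PS
bkSeries k n = + bk k n

⊛-geomQ : ∀ (g : ℕ → ℕ) c → .{{_ : NonZero c}} → ∀ n →
  ((λ i → + g i) ⊛ geomQ c) n ≡ + sumNat n (λ r → if ⌊ r * c ℕ.≤? n ⌋ then g (n ∸ r * c) else 0)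
⊛-geomQ g c n = begin
    ((λ i → + g i) ⊛ geomQ c) n
  ≡⟨ ⊛-comm (λ i → + g i) (geomQ c) n ⟩
    sumUpTo n (λ i → geomQ c i ℤ.* + g (n ∸ i))
  ≡⟨ sumUpTo≡sumBelow n _ ⟩
    sumBelow (suc n) (λ i → geomQ c i ℤ.* + g (n ∸ i))
  ≡⟨ sumBelow-cong (suc n) (λ i i≤n → cong (geomQ c i ℤ.*_) (sym (if-yes (i ℕ.≤? n) (ℕP.≤-pred i≤n)))) ⟩
    sumBelow (suc n) term
  ≡⟨ sym (sumBelow-extend (suc n) (c * suc n) term n<c*[1+n] term-beyond) ⟩
    sumBelow (c * suc n) term
  ≡⟨ sumBelow-dilate (suc n) (λ _ → ℤ.1ℤ) G ⟩
    sumBelow (suc n) (λ t → ℤ.1ℤ ℤ.* G (c * t))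
  ≡⟨ sumBelow-cong (suc n) (λ t _ → trans (ℤP.*-identityˡ (G (c * t))) (G-multiple t)) ⟩
    sumBelow (suc n) (λ r → + (if ⌊ r * c ℕ.≤? n ⌋ then g (n ∸ r * c) else 0))
  ≡⟨ sym (+-sumNat n _) ⟩
    + sumNat n (λ r → if ⌊ r * c ℕ.≤? n ⌋ then g (n ∸ r * c) else 0)
  ∎
  where
  open ≡-Reasoning
  -- geomQ c is, by definition, the dilation by c of the constant series 1.
  open Dilation c using (sumBelow-dilate)
  G : ℕ → ℤ
  G i = if ⌊ i ℕ.≤? n ⌋ then + g (n ∸ i) else ℤ.0ℤ
  term : ℕ → ℤ
  term i = geomQ c i ℤ.* G i
  n<c*[1+n] : suc n ≤ c * suc n
  n<c*[1+n] = n<a*[1+n] c n (ℕ.>-nonZero⁻¹ c)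
  term-beyond : ∀ i → suc n ≤ i → term i ≡ ℤ.0ℤ
  term-beyond i n<i = trans (cong (geomQ c i ℤ.*_) (if-no (i ℕ.≤? n) (ℕP.<⇒≱ n<i))) (ℤP.*-zeroʳ (geomQ c i))
  G-multiple : ∀ t → G (c * t) ≡ + (if ⌊ t * c ℕ.≤? n ⌋ then g (n ∸ t * c) else 0)
  G-multiple t rewrite ℕP.*-comm c t with t * c ℕ.≤? n
  ... | yes _ = refl
  ... | no _  = refl

module Partitions (k′ : ℕ) where

  k = suc k′

  partFactor : ℕ → PS
  partFactor n = if ⌊ k ℕD.∣? suc n ⌋ then onePS else geomQ (suc n)

  finProd-partFactor : ∀ b → finProd b partFactor ≗ (λ n → + partsBounded k b n)
  finProd-partFactor zero    zero    = refl
  finProd-partFactor zero    (suc n) = refl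
  finProd-partFactor (suc b) n with k ℕD.∣? suc b
  ... | yes _ = trans (⊛-identityʳ (finProd b partFactor) n) (finProd-partFactor b n)
  ... | no _  = trans (⊛-congˡ (geomQ (suc b)) (finProd-partFactor b) n) (⊛-geomQ (partsBounded k b) (suc b) n)

  -- The factors 1 - q^n with k ∣ n: their product is E(k), and dividing it by E(1) leaves
  -- ∏_{k ∤ n} (1 - q^n)^{-1}, the generating function of b_k.
  multipleFactor : ℕ → PS
  multipleFactor n = if ⌊ k ℕD.∣? suc n ⌋ then oneMinusQ (suc n) else onePS

  multipleFactor-one : OneUpToIndex multipleFactor
  multipleFactor-one n with k ℕD.∣? suc n
  ... | yes _ = oneMinusQ-agree (suc n) n ℕP.≤-refl
  ... | no _  = λ _ _ → refl

  finProd-multipleFactor : ∀ b → finProd (k * b) multipleFactor ≈[ 0 ] finProd b (eulerFactor k)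
  finProd-multipleFactor zero = ≗⇒≈ (λ i → cong (λ x → finProd x multipleFactor i) (ℕP.*-zeroʳ k))
  finProd-multipleFactor (suc b) = begin
      finProd (k * suc b) multipleFactor
    ≡⟨ cong (λ x → finProd x multipleFactor) k[1+b] ⟩
      finProd (k * b + k) multipleFactor
    ≈⟨ finProd-split (k * b) k multipleFactor ⟩
      finProd (k * b) multipleFactor ⊛ finProd k (λ r → multipleFactor (k * b + r))
    ≈⟨ *-cong (finProd-multipleFactor b) (*-cong non-multiples (≗⇒≈ multiple)) ⟩
      finProd b (eulerFactor k) ⊛ (onePS ⊛ eulerFactor k b)
    ≈⟨ *-cong (≈-refl {finProd b (eulerFactor k)}) (*-identityˡ (eulerFactor k b)) ⟩
      finProd (suc b) (eulerFactor k)
    ∎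
    where
    open SeriesMod 0
    open ≈-Reasoning
    k[1+b] : k * suc b ≡ k * b + k
    k[1+b] = trans (ℕP.*-suc k b) (ℕP.+-comm k (k * b))
    1+kb+k′≡k[1+b] : suc (k * b + k′) ≡ k * suc b
    1+kb+k′≡k[1+b] = solve k′ b
      where solve : ∀ k′ b → suc (suc k′ * b + k′) ≡ suc k′ * suc b
            solve = ℕSolver.solve-∀
    non-multiples : finProd k′ (λ r → multipleFactor (k * b + r)) ≈[ 0 ] onePS
    non-multiples = finProd-ones k′ _ (λ r r<k′ →
      ≗⇒≈ (λ i → cong (λ F → F i) (if-no (k ℕD.∣? suc (k * b + r)) {oneMinusQ (suc (k * b + r))} {onePS} (k∤ r r<k′))))
      where
      k∤ : ∀ r → r < k′ → ¬ (k ℕD.∣ suc (k * b + r))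
      k∤ r r<k′ k∣ = ℕP.<⇒≱ (s≤s r<k′)
        (ℕD.∣⇒≤ (ℕD.∣m+n∣m⇒∣n (subst (k ℕD.∣_) (sym (ℕP.+-suc (k * b) r)) k∣) (ℕD.m∣m*n b)))
    multiple : multipleFactor (k * b + k′) ≗ eulerFactor k b
    multiple i = trans (cong (λ F → F i) (if-yes (k ℕD.∣? suc (k * b + k′)) {oneMinusQ (suc (k * b + k′))} {onePS}
                                                 (subst (k ℕD.∣_) (sym 1+kb+k′≡k[1+b]) (ℕD.m∣m*n (suc b)))))
                       (cong (λ c → oneMinusQ c i) 1+kb+k′≡k[1+b])

  eulerProd-agree-multiples : ∀ x → AgreeUpTo x (eulerProd k) (finProd x multipleFactor)
  eulerProd-agree-multiples x i i≤x = begin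
      finProd i (eulerFactor k) i
    ≡⟨ sym (≈[0]⇒≗ (finProd-multipleFactor i) i) ⟩
      finProd (k * i) multipleFactor i
    ≡⟨ finProd-stable multipleFactor multipleFactor-one (ℕP.m≤n*m i k) ⟩
      finProd i multipleFactor i
    ≡⟨ sym (finProd-stable multipleFactor multipleFactor-one i≤x) ⟩
      finProd x multipleFactor i
    ∎
    where open ≡-Reasoning

  multipleFactor⊛geomQ : ∀ n → (multipleFactor n ⊛ geomQ (suc n)) ≈[ 0 ] partFactor n
  multipleFactor⊛geomQ n with k ℕD.∣? suc n
  ... | yes _ = oneMinusQ⊛geomQ (suc n) (s≤s z≤n)
  ... | no _  = SeriesMod.*-identityˡ 0 (geomQ (suc n))

  multipleFactor⊛eulerFactorInv : ∀ n → (multipleFactor n ⊛ eulerFactorInv 1 n) ≈[ 0 ] partFactor n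
  multipleFactor⊛eulerFactorInv n =
    subst (λ c → (multipleFactor n ⊛ geomQ c) ≈[ 0 ] partFactor n) (sym (ℕP.*-identityˡ (suc n))) (multipleFactor⊛geomQ n)

  bk-generating-function : (eulerProd k ⊛ eulerProdInv 1) ≗ bkSeries k
  bk-generating-function x = begin
      (eulerProd k ⊛ eulerProdInv 1) x
    ≡⟨ AgreeUpTo-⊛ (eulerProd k) (eulerProdInv 1) (eulerProd-agree-multiples x) (eulerProdInv-agree 1 (s≤s z≤n) x)
                   x ℕP.≤-refl ⟩
      (finProd x multipleFactor ⊛ finProd x (eulerFactorInv 1)) x
    ≡⟨ ≈[0]⇒≗ (≈-trans (finProd-⊛ x multipleFactor (eulerFactorInv 1)) (finProd-cong x multipleFactor⊛eulerFactorInv)) x ⟩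
      finProd x partFactor x
    ≡⟨ finProd-partFactor x x ⟩
      + bk k x
    ∎
    where
    open ≡-Reasoning
    open SeriesMod 0 using (≈-trans; finProd-⊛; finProd-cong)

-- Laurent series

shift-powL : ∀ X e → shift (powL X e) ≡ + e ℤ.* shift X
shift-powL X zero    = sym (ℤP.*-zeroˡ (shift X))
shift-powL X (suc e) = begin
    shift X ℤ.+ shift (powL X e)
  ≡⟨ cong (ℤ._+_ (shift X)) (shift-powL X e) ⟩
    shift X ℤ.+ + e ℤ.* shift X
  ≡⟨ sym (ℤP.suc-* (+ e) (shift X)) ⟩
    + suc e ℤ.* shift X
  ∎
  where open ≡-Reasoning

coeffs-powL : ∀ X e → coeffs (powL X e) ≗ powPS (coeffs X) e
coeffs-powL X zero    n = refl
coeffs-powL X (suc e)   = ⊛-congʳ (coeffs X) (coeffs-powL X e)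

coeffAt-+ : ∀ L S n → shift L ≡ + S → coeffAt L (+ n) ≡ shiftPS S (coeffs L) n
coeffAt-+ ⟨ _ , f ⟩ S n refl with + S ℤ.≤? + n
... | yes (ℤ.+≤+ S≤n) = trans (cong (λ x → f ℤ.∣ x ∣) (trans (ℤP.[+m]-[+n]≡m⊖n n S) (ℤP.⊖-≥ S≤n)))
                              (sym (shiftPS-≤ f S≤n))
... | no  S≰n         = sym (shiftPS-< f (ℕP.≰⇒> (λ S≤n → S≰n (ℤ.+≤+ S≤n))))

coeffs-U : ∀ d L S → shift L ≡ + S → coeffs (U d L) ≗ (λ n → shiftPS S (coeffs L) (d * n))
coeffs-U d L S shift≡S n = begin
    coeffAt L (+ d ℤ.* (shift L ℤ.⊓ ℤ.0ℤ ℤ.+ + n))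
  ≡⟨ cong (λ s → coeffAt L (+ d ℤ.* (s ℤ.⊓ ℤ.0ℤ ℤ.+ + n))) shift≡S ⟩
    coeffAt L (+ d ℤ.* (+ S ℤ.⊓ ℤ.0ℤ ℤ.+ + n))
  ≡⟨ cong (λ s → coeffAt L (+ d ℤ.* (s ℤ.+ + n))) (ℤP.i≥j⇒i⊓j≡j (ℤ.+≤+ z≤n)) ⟩
    coeffAt L (+ d ℤ.* (ℤ.0ℤ ℤ.+ + n))
  ≡⟨ cong (λ x → coeffAt L (+ d ℤ.* x)) (ℤP.+-identityˡ (+ n)) ⟩
    coeffAt L (+ d ℤ.* + n)
  ≡⟨ cong (coeffAt L) (sym (ℤP.pos-* d n)) ⟩
    coeffAt L (+ (d * n))
  ≡⟨ coeffAt-+ L S (d * n) shift≡S ⟩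
    shiftPS S (coeffs L) (d * n)
  ∎
  where open ≡-Reasoning

nonNegativePart : PS → ℤ → ℤ
nonNegativePart W (+ n)      = W n
nonNegativePart W -[1+ _ ] = ℤ.0ℤ

coeffAt-negsuc : ∀ {M} L s (W : PS) → shift L ≡ -[1+ s ] → coeffs L ≈[ M ] shiftPS (suc s) W →
                 ∀ e → coeffAt L e ≡[ M ] nonNegativePart W e
coeffAt-negsuc ⟨ _ , f ⟩ s W refl f≈W e with -[1+ s ] ℤ.≤? e
coeffAt-negsuc {M} ⟨ _ , f ⟩ s W refl f≈W (+ n) | yes _ =
  subst (λ i → f i ≡[ M ] W n) (cong ℤ.∣_∣ (sym (ℤP.pos-+ n (suc s))))
    (≡[]-trans (f≈W (n + suc s))
               (≡[]-reflexive (trans (shiftPS-≤ W (ℕP.m≤n+m (suc s) n)) (cong W (ℕP.m+n∸n≡m n (suc s))))))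
coeffAt-negsuc {M} ⟨ _ , f ⟩ s W refl f≈W -[1+ t ] | yes (ℤ.-≤- t≤s) =
  subst (λ i → f i ≡[ M ] ℤ.0ℤ) (cong ℤ.∣_∣ (sym (trans (ℤP.[1+m]⊖[1+n]≡m⊖n s t) (ℤP.⊖-≥ t≤s))))
    (≡[]-trans (f≈W (s ∸ t)) (≡[]-reflexive (shiftPS-< W (s≤s (ℕP.m∸n≤m s t)))))
coeffAt-negsuc ⟨ _ , f ⟩ s W refl f≈W (+ n)    | no ¬-≤+ = ⊥-elim (¬-≤+ ℤ.-≤+)
coeffAt-negsuc ⟨ _ , f ⟩ s W refl f≈W -[1+ t ] | no _    = ≡[]-refl ℤ.0ℤ

module EtaQuotient (k′ m : ℕ) .{{_ : NonZero m}} where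

  k = suc k′

  rhsSeries : PS
  rhsSeries t = rhsCoeff k m (+ t)

  L : Laurent
  L = eta24 k ·L (powL (eta24 m) m ·L eta24Inv 1)

  shift-L : shift L ≡ + (k′ + m * m)
  shift-L = begin
      + k ℤ.+ (shift (powL (eta24 m) m) ℤ.+ ℤ.-1ℤ)
    ≡⟨ cong (λ s → + k ℤ.+ (s ℤ.+ ℤ.-1ℤ)) (trans (shift-powL (eta24 m) m) (sym (ℤP.pos-* m m))) ⟩
      + suc k′ ℤ.+ (+ (m * m) ℤ.+ ℤ.-1ℤ)
    ≡⟨ cancel-one (+ k′) (+ (m * m)) ⟩
      + k′ ℤ.+ + (m * m)
    ≡⟨ sym (ℤP.pos-+ k′ (m * m)) ⟩
      + (k′ + m * m)
    ∎
    where
    open ≡-Reasoning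
    cancel-one : ∀ a b → (ℤ.1ℤ ℤ.+ a) ℤ.+ (b ℤ.+ ℤ.-1ℤ) ≡ a ℤ.+ b
    cancel-one = solve-∀

  bk-generating-function-24 : (eulerProd (24 * k) ⊛ eulerProdInv 24) ≗ Dilation.dilate 24 (bkSeries k)
  bk-generating-function-24 n = sym (begin
      dilate (bkSeries k) n
    ≡⟨ dilate-cong (λ x → sym (Partitions.bk-generating-function k′ x)) n ⟩
      dilate (eulerProd k ⊛ eulerProdInv 1) n
    ≡⟨ dilate-⊛ (eulerProd k) (eulerProdInv 1) n ⟩
      (dilate (eulerProd k) ⊛ dilate (eulerProdInv 1)) n
    ≡⟨ ⊛-cong (dilate-eulerProd k (s≤s z≤n)) (dilate-eulerProdInv 1 (s≤s z≤n)) n ⟩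
      (eulerProd (24 * k) ⊛ eulerProdInv 24) n
    ∎)
    where
    open ≡-Reasoning
    open Dilation 24

  rhsSeries-shift : ∀ t → shiftPS k′ (eulerProd (24 * k) ⊛ eulerProdInv 24) (m * t) ≡ rhsSeries t
  rhsSeries-shift t with k′ ℕ.≤? m * t
  ... | yes _ = bk-generating-function-24 (m * t ∸ k′)
  ... | no _  = refl

  dilate-eulerProd-24 : Dilation.dilate m (powPS (eulerProd 24) m) ≗ powPS (eulerProd (24 * m)) m
  dilate-eulerProd-24 n = trans (dilate-powPS (eulerProd 24) m n)
    (≈[0]⇒≗ (SeriesMod.powPS-cong 0 m (≗⇒≈ (λ i → trans (dilate-eulerProd 24 (s≤s z≤n) i)
                                                        (cong (λ a → eulerProd a i) (ℕP.*-comm m 24))))) n)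
    where open Dilation m

  coeffs-L : coeffs L ≈[ 0 ] ((eulerProd (24 * k) ⊛ eulerProdInv 24) ⊛ powPS (eulerProd (24 * m)) m)
  coeffs-L = ≈-trans (*-cong (≈-refl {eulerProd (24 * k)}) (*-cong (≗⇒≈ (coeffs-powL (eta24 m) m)) (≈-refl {eulerProdInv 24})))
    (prove 3 (var 0F ∙ (var 1F ∙ var 2F)) ((var 0F ∙ var 2F) ∙ var 1F)
             (eulerProd (24 * k) ∷ powPS (eulerProd (24 * m)) m ∷ eulerProdInv 24 ∷ []))
    where
    open SeriesMod 0
    open ⊛-Solver using (prove; var) renaming (_⊕_ to _∙_)

  -- η^m(24mz) is q^{m²} E(24)^m(q^m), a dilation by m, which U(m) passes through (⊛-dilate).
  coeffs-UL : coeffs (U m L) ≗ (rhsSeries ⊛ (monomial m ⊛ powPS (eulerProd 24) m))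
  coeffs-UL n = begin
      coeffs (U m L) n
    ≡⟨ coeffs-U m L (k′ + m * m) shift-L n ⟩
      shiftPS (k′ + m * m) (coeffs L) (m * n)
    ≡⟨ sym (monomial-⊛ (k′ + m * m) (coeffs L) (m * n)) ⟩
      (monomial (k′ + m * m) ⊛ coeffs L) (m * n)
    ≡⟨ ≈[0]⇒≗ separate-dilated-part (m * n) ⟩
      ((monomial k′ ⊛ B) ⊛ dilate (monomial m ⊛ powPS (eulerProd 24) m)) (m * n)
    ≡⟨ ⊛-dilate (monomial k′ ⊛ B) (monomial m ⊛ powPS (eulerProd 24) m) n ⟩
      ((λ t → (monomial k′ ⊛ B) (m * t)) ⊛ (monomial m ⊛ powPS (eulerProd 24) m)) n
    ≡⟨ ⊛-congˡ (monomial m ⊛ powPS (eulerProd 24) m) (λ t → trans (monomial-⊛ k′ B (m * t)) (rhsSeries-shift t)) n ⟩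
      (rhsSeries ⊛ (monomial m ⊛ powPS (eulerProd 24) m)) n
    ∎
    where
    open ≡-Reasoning
    open Dilation m
    B = eulerProd (24 * k) ⊛ eulerProdInv 24
    E = powPS (eulerProd (24 * m)) m
    dilate-part : dilate (monomial m ⊛ powPS (eulerProd 24) m) ≗ (monomial (m * m) ⊛ E)
    dilate-part i = trans (dilate-⊛ (monomial m) (powPS (eulerProd 24) m) i)
                          (⊛-cong (dilate-monomial m) dilate-eulerProd-24 i)
    separate-dilated-part :
      (monomial (k′ + m * m) ⊛ coeffs L) ≈[ 0 ] ((monomial k′ ⊛ B) ⊛ dilate (monomial m ⊛ powPS (eulerProd 24) m))
    separate-dilated-part = ≈-trans
      (*-cong (≗⇒≈ (λ i → sym (monomial-⊛-monomial k′ (m * m) i))) coeffs-L)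
      (≈-trans (prove 4 ((var 0F ∙ var 1F) ∙ (var 2F ∙ var 3F)) ((var 0F ∙ var 2F) ∙ (var 1F ∙ var 3F))
                        (monomial k′ ∷ monomial (m * m) ∷ B ∷ E ∷ []))
               (*-cong (≈-refl {monomial k′ ⊛ B}) (≗⇒≈ (λ i → sym (dilate-part i)))))
      where
      open SeriesMod 0
      open ⊛-Solver using (prove; var) renaming (_⊕_ to _∙_)

  module _ (j : ℕ) where

    M = m ^ suc j

    m≤M : m ≤ M
    m≤M = ℕP.m≤m*n m (m ^ j) {{ℕP.m^n≢0 m j}}

    fkmj-shift : shift (fkmj k m j) ≡ ℤ.- (+ m)
    fkmj-shift = begin
        shift (U m L) ℤ.+ (shift (powL (eta24 1) (M ∸ m)) ℤ.+ shift (powL (eta24Inv m) (m ^ j)))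
      ≡⟨ cong₂ ℤ._+_ U-shift (cong₂ ℤ._+_ (shift-powL (eta24 1) (M ∸ m)) (shift-powL (eta24Inv m) (m ^ j))) ⟩
        ℤ.0ℤ ℤ.+ (+ (M ∸ m) ℤ.* ℤ.1ℤ ℤ.+ + (m ^ j) ℤ.* ℤ.- (+ m))
      ≡⟨ collect (+ (M ∸ m)) (+ (m ^ j)) (+ m) ⟩
        + (M ∸ m) - + (m ^ j) ℤ.* + m
      ≡⟨ cong (λ x → + (M ∸ m) - x) (trans (sym (ℤP.pos-* (m ^ j) m)) (cong +_ M≡[M∸m]+m)) ⟩
        + (M ∸ m) - + (M ∸ m + m)
      ≡⟨ cong (λ x → + (M ∸ m) - x) (ℤP.pos-+ (M ∸ m) m) ⟩
        + (M ∸ m) - (+ (M ∸ m) ℤ.+ + m)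
      ≡⟨ cancel (+ (M ∸ m)) (+ m) ⟩
        ℤ.- (+ m)
      ∎
      where
      open ≡-Reasoning
      U-shift : shift L ℤ.⊓ ℤ.0ℤ ≡ ℤ.0ℤ
      U-shift = trans (cong (ℤ._⊓ ℤ.0ℤ) shift-L) (ℤP.i≥j⇒i⊓j≡j (ℤ.+≤+ z≤n))
      M≡[M∸m]+m : m ^ j * m ≡ M ∸ m + m
      M≡[M∸m]+m = trans (ℕP.*-comm (m ^ j) m) (sym (ℕP.m∸n+n≡m m≤M))
      collect : ∀ a b c → ℤ.0ℤ ℤ.+ (a ℤ.* ℤ.1ℤ ℤ.+ b ℤ.* ℤ.- c) ≡ a - b ℤ.* c
      collect = solve-∀
      cancel : ∀ a c → a - (a ℤ.+ c) ≡ ℤ.- c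
      cancel = solve-∀

    fkmj-coeffs : Prime m → coeffs (fkmj k m j) ≈[ M ] shiftPS m rhsSeries
    fkmj-coeffs pm = begin
        coeffs (U m L) ⊛ (coeffs (powL (eta24 1) (M ∸ m)) ⊛ coeffs (powL (eta24Inv m) (m ^ j)))
      ≈⟨ *-cong (≗⇒≈ coeffs-UL)
                (*-cong (≗⇒≈ (coeffs-powL (eta24 1) (M ∸ m))) (≗⇒≈ (coeffs-powL (eta24Inv m) (m ^ j)))) ⟩
        (rhsSeries ⊛ (monomial m ⊛ E^ m)) ⊛ (E^ (M ∸ m) ⊛ I)
      ≈⟨ prove 5 ((w ∙ (x ∙ e)) ∙ (e′ ∙ i)) ((x ∙ w) ∙ ((e ∙ e′) ∙ i))
                 (rhsSeries ∷ monomial m ∷ E^ m ∷ E^ (M ∸ m) ∷ I ∷ []) ⟩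
        (monomial m ⊛ rhsSeries) ⊛ ((E^ m ⊛ E^ (M ∸ m)) ⊛ I)
      ≈⟨ *-cong (≈-refl {monomial m ⊛ rhsSeries}) (*-cong (≈-sym (powPS-+ (eulerProd 24) m (M ∸ m))) (≈-refl {I})) ⟩
        (monomial m ⊛ rhsSeries) ⊛ (E^ (m + (M ∸ m)) ⊛ I)
      ≡⟨ cong (λ e → (monomial m ⊛ rhsSeries) ⊛ (E^ e ⊛ I)) (ℕP.m+[n∸m]≡n m≤M) ⟩
        (monomial m ⊛ rhsSeries) ⊛ (E^ M ⊛ I)
      ≈⟨ *-cong (≈-refl {monomial m ⊛ rhsSeries}) (*-cong (eulerProd-prime-power pm 24 (s≤s z≤n) j) (≈-refl {I})) ⟩
        (monomial m ⊛ rhsSeries) ⊛ (powPS (eulerProd (24 * m)) (m ^ j) ⊛ I)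
      ≈⟨ *-cong (≈-refl {monomial m ⊛ rhsSeries}) eta-cancel ⟩
        (monomial m ⊛ rhsSeries) ⊛ onePS
      ≈⟨ *-identityʳ (monomial m ⊛ rhsSeries) ⟩
        monomial m ⊛ rhsSeries
      ≈⟨ ≗⇒≈ (monomial-⊛ m rhsSeries) ⟩
        shiftPS m rhsSeries
      ∎
      where
      open SeriesMod M
      open ≈-Reasoning
      open ⊛-Solver using (prove; var) renaming (_⊕_ to _∙_)
      w = var 0F
      x = var 1F
      e = var 2F
      e′ = var 3F
      i = var 4F
      E^ = powPS (eulerProd 24)
      I = powPS (eulerProdInv (24 * m)) (m ^ j)
      eta-cancel : (powPS (eulerProd (24 * m)) (m ^ j) ⊛ I) ≈[ M ] onePS
      eta-cancel = ≈-trans (≈-sym (powPS-distrib-⊛ (eulerProd (24 * m)) (eulerProdInv (24 * m)) (m ^ j)))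
                           (≈-trans (powPS-cong (m ^ j) (eulerProd⊛eulerProdInv (24 * m) 1≤24m)) (powPS-onePS (m ^ j)))
        where 1≤24m = ℕP.*-mono-≤ {1} {24} (s≤s z≤n) (ℕ.>-nonZero⁻¹ m)

proposition2p5 : (j m k : ℕ) → 1 ≤ j → Prime m → 5 ≤ m → 2 ≤ k →
    (e : ℤ) → (+ (m ^ suc j)) ∣ (coeffAt (fkmj k m j) e - rhsCoeff k m e)
proposition2p5 j zero     k       _ pm _ _ e = ⊥-elim (NonZero.nonZero (prime⇒nonZero pm))
proposition2p5 j (suc m′) zero    _ _  _ () e
proposition2p5 j (suc m′) (suc k′) _ pm _ _ e = ℤD.∣⇒∣ᵤ (divides-difference (≡[]-trans
    (coeffAt-negsuc (fkmj (suc k′) (suc m′) j) m′ rhsSeries (fkmj-shift j) (fkmj-coeffs j pm) e)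
    (≡[]-reflexive (nonNegativePart-rhs e))))
  where
  open EtaQuotient k′ (suc m′)
  nonNegativePart-rhs : ∀ e → nonNegativePart rhsSeries e ≡ rhsCoeff (suc k′) (suc m′) e
  nonNegativePart-rhs (+ n)    = refl
  nonNegativePart-rhs -[1+ n ] = refl
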